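{- For each $L\in\{\mathsf{ND},\mathsf{NP},\mathsf{ND4},\mathsf{NP4}\}$, there exists a primitive recursive decision procedure for the $L$-provability problem, i.e., the set of modal formulas provable in $L$ is primitive recursive.
   Context: $\mathsf{N}$ is classical propositional logic in the modal language plus the necessitation rule (from $A$ infer $\Box A$). $\mathsf{NP}=\mathsf{N}+\neg\Box\bot$; $\mathsf{ND}=\mathsf{N}+\neg(\Box A\wedge\Box\neg A)$ (axiom scheme); $\mathsf{NP4}=\mathsf{NP}+(\Box A\to\Box\Box A)$; $\mathsf{ND4}=\mathsf{ND}+(\Box A\to\Box\Box A)$. -}

module Defs where

open import Data.Nat using (ℕ; zero; suc; _+_)
open import Data.Fin using (Fin)
open import Data.Vec using (Vec; []; _∷_; lookup)

infixr 6 _⇒_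
data Fm : Set where
  var : ℕ → Fm
  ⊥'  : Fm
  _⇒_ : Fm → Fm → Fm
  □_  : Fm → Fm

¬'_ : Fm → Fm
¬' A = A ⇒ ⊥'

_∧'_ : Fm → Fm → Fm
A ∧' B = ¬' (A ⇒ ¬' B)

data Logic : Set where
  ND NP ND4 NP4 : Logic

data ExtraAx : Logic → Fm → Set where
  P-NP   : ExtraAx NP  (¬' (□ ⊥'))
  P-NP4  : ExtraAx NP4 (¬' (□ ⊥'))
  D-ND   : ∀ A → ExtraAx ND  (¬' ((□ A) ∧' (□ (¬' A))))
  D-ND4  : ∀ A → ExtraAx ND4 (¬' ((□ A) ∧' (□ (¬' A))))
  4-ND4  : ∀ A → ExtraAx ND4 ((□ A) ⇒ (□ (□ A)))
  4-NP4  : ∀ A → ExtraAx NP4 ((□ A) ⇒ (□ (□ A)))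

-- Note: N has no K axiom.
data _⊢_ (L : Logic) : Fm → Set where
  ax1   : ∀ A B → L ⊢ (A ⇒ (B ⇒ A))
  ax2   : ∀ A B C → L ⊢ ((A ⇒ (B ⇒ C)) ⇒ ((A ⇒ B) ⇒ (A ⇒ C)))
  ax3   : ∀ A → L ⊢ ((¬' (¬' A)) ⇒ A)
  extra : ∀ {A} → ExtraAx L A → L ⊢ A
  mp    : ∀ {A B} → L ⊢ (A ⇒ B) → L ⊢ A → L ⊢ B
  nec   : ∀ {A} → L ⊢ A → L ⊢ (□ A)

data PR : ℕ → Set where
  zer  : ∀ {n} → PR n
  succ : PR 1
  proj : ∀ {n} → Fin n → PR n
  comp : ∀ {k n} → PR k → Vec (PR n) k → PR n
  rec  : ∀ {n} → PR n → PR (suc (suc n)) → PR (suc n)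

mutual
  eval : ∀ {n} → PR n → Vec ℕ n → ℕ
  eval zer        xs = 0
  eval succ       (x ∷ []) = suc x
  eval (proj i)   xs = lookup xs i
  eval (comp f gs) xs = eval f (evalAll gs xs)
  eval (rec g h)  (zero  ∷ xs) = eval g xs
  eval (rec g h)  (suc m ∷ xs) = eval h (m ∷ eval (rec g h) (m ∷ xs) ∷ xs)

  evalAll : ∀ {k n} → Vec (PR n) k → Vec ℕ n → Vec ℕ k
  evalAll []       xs = []
  evalAll (g ∷ gs) xs = eval g xs ∷ evalAll gs xs

tri : ℕ → ℕ
tri zero    = zero
tri (suc n) = suc n + tri n

pair : ℕ → ℕ → ℕ
pair a b = tri (a + b) + b

code : Fm → ℕ
code (var n) = pair 0 n
code ⊥'      = pair 1 0
code (A ⇒ B) = pair 2 (pair (code A) (code B))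
code (□ A)   = pair 3 (code A)

{-# OPTIONS --safe #-}
-- In N and its extensions a boxed formula □X behaves like a propositional atom, constrained
-- only by facts about smaller formulas: □X holds if ⊢ X (necessitation), □⊥ fails (P),
-- □Y implies □□Y (4), and with D, □X fails if ⊢ ¬□X and is incompatible with □¬X (and, with 4,
-- with □¬□X).  A formula A is provable iff it is true under every valuation of its atoms that
-- satisfies these constraints at the boxed subformulas of A.  Provability of ¬□X is characterised
-- in the same way: ⊢ ¬X, or X = ¬E with ⊢ E, or (with 4) X = □Y with ⊢ ¬□Y.  So provability,
-- refutability and □-refutability of the formula with code n are computed by course-of-values
-- recursion on n, each step a bounded search through the valuations of finitely many atoms, and
-- the decision procedure is primitive recursive.
--
-- The constraints are tautological consequences of theorems about smaller formulas, which makes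
-- the criterion complete.  Soundness is by induction on derivations; for modus ponens, a valuation
-- admissible for B is extended to all formulas by making □X true outside B exactly when ⊢ X or
-- (with 4) X = □Y with □Y already true.

module Submission where

open import Defs
open import Data.Nat
open import Data.Nat.Properties
open import Data.Nat.Induction using (<-wellFounded)
open import Data.Bool using (Bool; true; false; if_then_else_; not; _∧_; _∨_; T)
open import Data.Bool.Properties using (∧-conicalˡ; ∧-conicalʳ; ∨-conicalʳ; ∧-zeroʳ; not-involutive)
open import Data.Empty using (⊥; ⊥-elim)
open import Data.Fin as Fin using (Fin; #_)
open import Data.Vec using (Vec; []; _∷_; lookup; tabulate; head; tail)
open import Data.Vec.N-ary using (_$ⁿ_)
open import Data.Vec.Properties using (tabulate∘lookup)
open import Data.List using (List; []; _∷_; _++_; map)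
open import Data.List.Membership.Propositional using (_∈_)
open import Data.List.Membership.Propositional.Properties using (∈-++⁺ˡ; ∈-++⁺ʳ; ∈-++⁻; ∈-map⁺)
open import Data.List.Relation.Unary.All as All using (All; []; _∷_)
import Data.List.Relation.Unary.All.Properties as Allₚ
open import Data.List.Relation.Unary.Any using (here; there; any?)
open import Data.Product using (Σ; Σ-syntax; _×_; _,_; proj₁; proj₂)
open import Data.Sum using (_⊎_; inj₁; inj₂; [_,_]′)
open import Function using (_∘_; id; _on_)
open import Induction.WellFounded as WF using (WellFounded)
import Relation.Binary.Construct.On as On
open import Relation.Binary using (tri<; tri≈; tri>)
open import Relation.Binary.PropositionalEquality
open import Relation.Nullary using (Dec; yes; no; ¬_)

tri-mono-≤ : ∀ {m n} → m ≤ n → tri m ≤ tri n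
tri-mono-≤ z≤n       = z≤n
tri-mono-≤ (s≤s m≤n) = +-mono-≤ (s≤s m≤n) (tri-mono-≤ m≤n)

n≤tri : ∀ n → n ≤ tri n
n≤tri zero    = z≤n
n≤tri (suc n) = m≤m+n (suc n) (tri n)

-- Opaque (as are several definitions below): unfolding it inside goals is very costly.
opaque
  triRoot : ℕ → ℕ
  triRoot zero    = zero
  triRoot (suc n) = if tri (suc (triRoot n)) ≤ᵇ suc n then suc (triRoot n) else triRoot n

  triRoot-spec : ∀ n → tri (triRoot n) ≤ n × n < tri (suc (triRoot n))
  triRoot-spec zero = z≤n , s≤s z≤n
  triRoot-spec (suc n) with triRoot-spec n | tri (suc (triRoot n)) ≤ᵇ suc n in le
  ... | _ , n<next | true  = ≤ᵇ⇒≤ _ _ (subst T (sym le) _)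
                            , s≤s (≤-trans n<next (m≤n+m (tri (suc (triRoot n))) (suc (triRoot n))))
  ... | low , _    | false = m≤n⇒m≤1+n low , ≰⇒> (λ next≤ → subst T le (≤⇒≤ᵇ next≤))

triRoot-unique : ∀ {d n} → tri d ≤ n → n < tri (suc d) → triRoot n ≡ d
triRoot-unique {d} {n} low high with <-cmp (triRoot n) d | triRoot-spec n
... | tri≈ _ eq _ | _          = eq
... | tri< r<d _ _ | _ , n<next = ⊥-elim (<-irrefl refl (<-≤-trans n<next (≤-trans (tri-mono-≤ r<d) low)))
... | tri> _ _ d<r | low′ , _   = ⊥-elim (<-irrefl refl (<-≤-trans high (≤-trans (tri-mono-≤ d<r) low′)))

triRoot-pair : ∀ a b → triRoot (pair a b) ≡ a + b
triRoot-pair a b = triRoot-unique (m≤m+n (tri (a + b)) b) pair<next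
  where
  pair<next : pair a b < tri (suc (a + b))
  pair<next = s≤s (subst (tri (a + b) + b ≤_) (+-comm (tri (a + b)) (a + b)) (+-monoʳ-≤ (tri (a + b)) (m≤n+m b a)))

unpair₂ : ℕ → ℕ
unpair₂ n = n ∸ tri (triRoot n)

unpair₁ : ℕ → ℕ
unpair₁ n = triRoot n ∸ unpair₂ n

unpair₂-pair : ∀ a b → unpair₂ (pair a b) ≡ b
unpair₂-pair a b rewrite triRoot-pair a b = m+n∸m≡n (tri (a + b)) b

unpair₁-pair : ∀ a b → unpair₁ (pair a b) ≡ a
unpair₁-pair a b rewrite unpair₂-pair a b | triRoot-pair a b = m+n∸n≡m a b

m≤pair[m,n] : ∀ m n → m ≤ pair m n
m≤pair[m,n] m n = ≤-trans (≤-trans (m≤m+n m n) (n≤tri (m + n))) (m≤m+n (tri (m + n)) n)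

n<pair[1+m,n] : ∀ m n → n < pair (suc m) n
n<pair[1+m,n] m n = +-monoˡ-≤ n (s≤s z≤n)

pair-mono-≤ : ∀ {a b c d} → a ≤ c → b ≤ d → pair a b ≤ pair c d
pair-mono-≤ a≤c b≤d = +-mono-≤ (tri-mono-≤ (+-mono-≤ a≤c b≤d)) b≤d

code-<-□ : ∀ A → code A < code (□ A)
code-<-□ A = n<pair[1+m,n] 2 (code A)

code-<-⇒ˡ : ∀ A B → code A < code (A ⇒ B)
code-<-⇒ˡ A B = ≤-<-trans (m≤pair[m,n] (code A) (code B)) (n<pair[1+m,n] 1 _)

code-<-⇒ʳ : ∀ A B → code B < code (A ⇒ B)
code-<-⇒ʳ A B = ≤-<-trans (m≤n+m (code B) (tri (code A + code B))) (n<pair[1+m,n] 1 _)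

caseTag : {X : Set} → ℕ → ℕ → (ℕ → X) → X → (ℕ → ℕ → X) → (ℕ → X) → X
caseTag 0 b onVar onBot onImp onBox = onVar b
caseTag 2 b onVar onBot onImp onBox = onImp (unpair₁ b) (unpair₂ b)
caseTag 3 b onVar onBot onImp onBox = onBox b
caseTag _ b onVar onBot onImp onBox = onBot

caseTag-map : ∀ {X Y : Set} (f : X → Y) c b onVar onBot onImp onBox
  → f (caseTag c b onVar onBot onImp onBox)
    ≡ caseTag c b (λ a → f (onVar a)) (f onBot) (λ a a′ → f (onImp a a′)) (λ a → f (onBox a))
caseTag-map f 0 b _ _ _ _ = refl
caseTag-map f 1 b _ _ _ _ = refl
caseTag-map f 2 b _ _ _ _ = refl
caseTag-map f 3 b _ _ _ _ = refl
caseTag-map f (suc (suc (suc (suc c)))) b _ _ _ _ = refl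

caseTag-if : ∀ {X : Set} c b (onVar : ℕ → X) onBot onImp onBox → caseTag c b onVar onBot onImp onBox ≡
  (if c ≡ᵇ 0 then onVar b else if c ≡ᵇ 2 then onImp (unpair₁ b) (unpair₂ b) else if c ≡ᵇ 3 then onBox b else onBot)
caseTag-if 0 b _ _ _ _ = refl
caseTag-if 1 b _ _ _ _ = refl
caseTag-if 2 b _ _ _ _ = refl
caseTag-if 3 b _ _ _ _ = refl
caseTag-if (suc (suc (suc (suc c)))) b _ _ _ _ = refl

-- Case analysis on the outermost constructor of the formula coded by n
-- (junk codes fall into the ⊥' branch).
opaque
  caseCode : {X : Set} → ℕ → (ℕ → X) → X → (ℕ → ℕ → X) → (ℕ → X) → X
  caseCode n = caseTag (unpair₁ n) (unpair₂ n)

  caseCode-map : ∀ {X Y : Set} (f : X → Y) n onVar onBot onImp onBox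
    → f (caseCode n onVar onBot onImp onBox)
      ≡ caseCode n (λ a → f (onVar a)) (f onBot) (λ a a′ → f (onImp a a′)) (λ a → f (onBox a))
  caseCode-map f n = caseTag-map f (unpair₁ n) (unpair₂ n)

  caseCode-if : ∀ {X : Set} n (onVar : ℕ → X) onBot onImp onBox → caseCode n onVar onBot onImp onBox ≡
    (if unpair₁ n ≡ᵇ 0 then onVar (unpair₂ n)
     else if unpair₁ n ≡ᵇ 2 then onImp (unpair₁ (unpair₂ n)) (unpair₂ (unpair₂ n))
     else if unpair₁ n ≡ᵇ 3 then onBox (unpair₂ n) else onBot)
  caseCode-if n = caseTag-if (unpair₁ n) (unpair₂ n)

  caseCode-pair : ∀ {X : Set} t b → caseCode {X} (pair t b) ≡ caseTag t b
  caseCode-pair t b = cong₂ caseTag (unpair₁-pair t b) (unpair₂-pair t b)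

module _ {X : Set} {onVar : ℕ → X} {onBot : X} {onImp : ℕ → ℕ → X} {onBox : ℕ → X} where

  caseCode-var : ∀ k → caseCode (code (var k)) onVar onBot onImp onBox ≡ onVar k
  caseCode-var k = cong (λ c → c onVar onBot onImp onBox) (caseCode-pair 0 k)

  caseCode-⊥ : caseCode (code ⊥') onVar onBot onImp onBox ≡ onBot
  caseCode-⊥ = cong (λ c → c onVar onBot onImp onBox) (caseCode-pair 1 0)

  caseCode-⇒ : ∀ A B → caseCode (code (A ⇒ B)) onVar onBot onImp onBox ≡ onImp (code A) (code B)
  caseCode-⇒ A B = trans (cong (λ c → c onVar onBot onImp onBox) (caseCode-pair 2 (pair (code A) (code B))))
                         (cong₂ onImp (unpair₁-pair (code A) (code B)) (unpair₂-pair (code A) (code B)))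

  caseCode-□ : ∀ A → caseCode (code (□ A)) onVar onBot onImp onBox ≡ onBox (code A)
  caseCode-□ A = cong (λ c → c onVar onBot onImp onBox) (caseCode-pair 3 (code A))

decodeWithFuel : ℕ → ℕ → Fm
decodeWithFuel zero    n = ⊥'
decodeWithFuel (suc f) n =
  caseCode n var ⊥' (λ a b → decodeWithFuel f a ⇒ decodeWithFuel f b) (λ a → □ decodeWithFuel f a)

-- Every code decreases strictly towards its subcodes, so fuel n suffices for code n.
decode : ℕ → Fm
decode n = decodeWithFuel (suc n) n

decodeWithFuel-code : ∀ A f → code A < f → decodeWithFuel f (code A) ≡ A
decodeWithFuel-code (var k) (suc f) _ = caseCode-var k
decodeWithFuel-code ⊥'      (suc f) _ = caseCode-⊥
decodeWithFuel-code (A ⇒ B) (suc f) (s≤s lt) = trans (caseCode-⇒ A B)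
  (cong₂ _⇒_ (decodeWithFuel-code A f (<-≤-trans (code-<-⇒ˡ A B) lt))
             (decodeWithFuel-code B f (<-≤-trans (code-<-⇒ʳ A B) lt)))
decodeWithFuel-code (□ A)   (suc f) (s≤s lt) = trans (caseCode-□ A)
  (cong □_ (decodeWithFuel-code A f (<-≤-trans (code-<-□ A) lt)))

decode-code : ∀ A → decode (code A) ≡ A
decode-code A = decodeWithFuel-code A (suc (code A)) ≤-refl

code-injective : ∀ {A B} → code A ≡ code B → A ≡ B
code-injective {A} {B} eq = trans (sym (decode-code A)) (trans (cong decode eq) (decode-code B))

infix 4 _≟ᶠ_
_≟ᶠ_ : (A B : Fm) → Dec (A ≡ B)
A ≟ᶠ B with code A ≟ code B
... | yes eq  = yes (code-injective eq)
... | no  neq = no (λ eq → neq (cong code eq))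

infix 4 _⊑_
data _⊑_ : Fm → Fm → Set where
  ⊑-refl : ∀ {A} → A ⊑ A
  ⊑-⇒ˡ   : ∀ {X A B} → X ⊑ A → X ⊑ A ⇒ B
  ⊑-⇒ʳ   : ∀ {X A B} → X ⊑ B → X ⊑ A ⇒ B
  ⊑-□    : ∀ {X A} → X ⊑ A → X ⊑ □ A

⊑-trans : ∀ {X Y Z} → X ⊑ Y → Y ⊑ Z → X ⊑ Z
⊑-trans p ⊑-refl   = p
⊑-trans p (⊑-⇒ˡ q) = ⊑-⇒ˡ (⊑-trans p q)
⊑-trans p (⊑-⇒ʳ q) = ⊑-⇒ʳ (⊑-trans p q)
⊑-trans p (⊑-□ q)  = ⊑-□ (⊑-trans p q)

□⊑⇒⊑ : ∀ {X A} → □ X ⊑ A → X ⊑ A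
□⊑⇒⊑ = ⊑-trans (⊑-□ ⊑-refl)

code-mono-⊑ : ∀ {X A} → X ⊑ A → code X ≤ code A
code-mono-⊑ ⊑-refl = ≤-refl
code-mono-⊑ {A = A ⇒ B} (⊑-⇒ˡ p) = ≤-trans (code-mono-⊑ p) (<⇒≤ (code-<-⇒ˡ A B))
code-mono-⊑ {A = A ⇒ B} (⊑-⇒ʳ p) = ≤-trans (code-mono-⊑ p) (<⇒≤ (code-<-⇒ʳ A B))
code-mono-⊑ {A = □ A}   (⊑-□ p)  = ≤-trans (code-mono-⊑ p) (<⇒≤ (code-<-□ A))

code-<-□⊑ : ∀ {X A} → □ X ⊑ A → code X < code A
code-<-□⊑ {X} p = <-≤-trans (code-<-□ X) (code-mono-⊑ p)

code-<⇒≢ : ∀ {Z Y} → code Z < code Y → Z ≢ Y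
code-<⇒≢ lt refl = <-irrefl refl lt

⋢-smaller : ∀ {X A} → code A < code X → ¬ X ⊑ A
⋢-smaller lt p = <-irrefl refl (<-≤-trans lt (code-mono-⊑ p))

□⊑□-split : ∀ {Z Y} → □ Z ⊑ □ Y → Z ≡ Y ⊎ □ Z ⊑ Y
□⊑□-split ⊑-refl  = inj₁ refl
□⊑□-split (⊑-□ p) = inj₂ p

□⊑¬⇒□⊑ : ∀ {Z A} → □ Z ⊑ ¬' A → □ Z ⊑ A
□⊑¬⇒□⊑ (⊑-⇒ˡ q) = q

infixr 5 _⇒ᵇ_
_⇒ᵇ_ : Bool → Bool → Bool
a ⇒ᵇ b = not a ∨ b

⇒ᵇ-intro : ∀ {a b} → (a ≡ true → b ≡ true) → (a ⇒ᵇ b) ≡ true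
⇒ᵇ-intro {true}  f = f refl
⇒ᵇ-intro {false} f = refl

⇒ᵇ-elim : ∀ {a b} → (a ⇒ᵇ b) ≡ true → a ≡ true → b ≡ true
⇒ᵇ-elim {true} b refl = b

⇒ᵇ-false : ∀ {a b} → (a ⇒ᵇ b) ≡ false → a ≡ true × b ≡ false
⇒ᵇ-false {true} {false} _ = refl , refl

not-true : ∀ {a} → not a ≡ true → a ≡ false
not-true {false} _ = refl

nand-intro : ∀ {a b} → (a ≡ true → b ≡ false) → not (a ∧ b) ≡ true
nand-intro {true}  f rewrite f refl = refl
nand-intro {false} f = refl

nand-elim : ∀ {a b} → not (a ∧ b) ≡ true → a ≡ true → b ≡ false
nand-elim {true} {false} _ _ = refl

∧ᵇ-intro : ∀ {a b} → a ≡ true → b ≡ true → (a ∧ b) ≡ true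
∧ᵇ-intro refl refl = refl

true≢false : true ≢ false
true≢false ()

∧-false : ∀ a {b} → (a ≡ true → b ≡ false) → (a ∧ b) ≡ false
∧-false true  f = f refl
∧-false false _ = refl

¬true⇒false : ∀ {b} → (b ≡ true → ⊥) → b ≡ false
¬true⇒false {true}  f = ⊥-elim (f refl)
¬true⇒false {false} _ = refl

∨-introʳ : ∀ a {b} → b ≡ true → (a ∨ b) ≡ true
∨-introʳ true  _ = refl
∨-introʳ false e = e

∨-introˡ : ∀ {a} b → a ≡ true → (a ∨ b) ≡ true
∨-introˡ b refl = refl

∨-true : ∀ a {b} → (a ∨ b) ≡ true → a ≡ true ⊎ b ≡ true
∨-true true  _ = inj₁ refl
∨-true false e = inj₂ e

contraposeᵇ : ∀ {a b} → (a ≡ true → b ≡ false) → b ≡ true → a ≡ false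
contraposeᵇ {false} f _ = refl
contraposeᵇ {true}  f b with () ← trans (sym b) (f refl)

≡ᵇ-true : ∀ {m n} → (m ≡ᵇ n) ≡ true → m ≡ n
≡ᵇ-true {m} {n} e = ≡ᵇ⇒≡ m n (subst T (sym e) _)

≡ᵇ-refl : ∀ n → (n ≡ᵇ n) ≡ true
≡ᵇ-refl zero    = refl
≡ᵇ-refl (suc n) = ≡ᵇ-refl n

-- Valuations give truth values to atoms (variables and boxed formulas) through
-- their codes, so that a valuation restricted to codes ≤ n is a finite object.
sem : (ℕ → Bool) → Fm → Bool
sem w (var n) = w (code (var n))
sem w ⊥'      = false
sem w (A ⇒ B) = sem w A ⇒ᵇ sem w B
sem w (□ A)   = w (code (□ A))

sem-local : ∀ A {w w′} → (∀ m → m ≤ code A → w m ≡ w′ m) → sem w A ≡ sem w′ A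
sem-local (var k) agree = agree _ ≤-refl
sem-local ⊥'      agree = refl
sem-local (B ⇒ C) agree = cong₂ _⇒ᵇ_
  (sem-local B (λ m m≤ → agree m (≤-trans m≤ (<⇒≤ (code-<-⇒ˡ B C)))))
  (sem-local C (λ m m≤ → agree m (≤-trans m≤ (<⇒≤ (code-<-⇒ʳ B C)))))
sem-local (□ B)   agree = agree _ ≤-refl

infix 3 _∣_⊢_
data _∣_⊢_ (L : Logic) (Γ : List Fm) : Fm → Set where
  hyp : ∀ {A} → A ∈ Γ → L ∣ Γ ⊢ A
  thm : ∀ {A} → L ⊢ A → L ∣ Γ ⊢ A
  mp  : ∀ {A B} → L ∣ Γ ⊢ (A ⇒ B) → L ∣ Γ ⊢ A → L ∣ Γ ⊢ B

module _ {L : Logic} where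

  ⊢-id : ∀ {Γ} A → L ∣ Γ ⊢ (A ⇒ A)
  ⊢-id A = mp (mp (thm (ax2 A (A ⇒ A) A)) (thm (ax1 A (A ⇒ A)))) (thm (ax1 A A))

  deduction : ∀ {Γ A B} → L ∣ A ∷ Γ ⊢ B → L ∣ Γ ⊢ (A ⇒ B)
  deduction {A = A} (hyp (here refl))  = ⊢-id A
  deduction {A = A} (hyp {B} (there p)) = mp (thm (ax1 B A)) (hyp p)
  deduction {A = A} (thm {B} d)         = mp (thm (ax1 B A)) (thm d)
  deduction {A = A} (mp {B} {C} d e)    = mp (mp (thm (ax2 A B C)) (deduction d)) (deduction e)

  weaken : ∀ {Γ A B} → L ∣ Γ ⊢ A → L ∣ B ∷ Γ ⊢ A
  weaken (hyp p)  = hyp (there p)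
  weaken (thm d)  = thm d
  weaken (mp d e) = mp (weaken d) (weaken e)

  ex-falso : ∀ {Γ} A → L ∣ Γ ⊢ ⊥' → L ∣ Γ ⊢ A
  ex-falso A d = mp (thm (ax3 A)) (mp (thm (ax1 ⊥' (¬' A))) d)

  ¬⇒-intro : ∀ {Γ A B} → L ∣ Γ ⊢ A → L ∣ Γ ⊢ ¬' B → L ∣ Γ ⊢ ¬' (A ⇒ B)
  ¬⇒-intro a ¬b = deduction (mp (weaken ¬b) (mp (hyp (here refl)) (weaken a)))

  by-cases : ∀ {Γ A F} → L ∣ Γ ⊢ (A ⇒ F) → L ∣ Γ ⊢ (¬' A ⇒ F) → L ∣ Γ ⊢ F
  by-cases {A = A} {F} a⇒f ¬a⇒f = mp (thm (ax3 F)) (deduction (mp (hyp (here refl)) (mp (weaken ¬a⇒f) ¬a)))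
    where
    ¬a : L ∣ ¬' F ∷ _ ⊢ ¬' A
    ¬a = deduction (mp (hyp (there (here refl))) (mp (weaken (weaken a⇒f)) (hyp (here refl))))

  discharge : ∀ {A} → L ∣ [] ⊢ A → L ⊢ A
  discharge (thm d)  = d
  discharge (mp d e) = mp (discharge d) (discharge e)

atoms : Fm → List Fm
atoms (var n) = var n ∷ []
atoms ⊥'      = []
atoms (A ⇒ B) = atoms A ++ atoms B
atoms (□ A)   = □ A ∷ []

literal : (ℕ → Bool) → Fm → Fm
literal w p = if w (code p) then p else ¬' p

signed : (ℕ → Bool) → Fm → Fm
signed w F = if sem w F then F else ¬' F

_⊆_ : List Fm → List Fm → Set
xs ⊆ ys = ∀ {x} → x ∈ xs → x ∈ ys

module _ {L : Logic} where

  kalmar : ∀ w F ps → atoms F ⊆ ps → L ∣ map (literal w) ps ⊢ signed w F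
  kalmar w (var n) ps sub = hyp (∈-map⁺ (literal w) (sub (here refl)))
  kalmar w ⊥'      ps sub = ⊢-id ⊥'
  kalmar w (□ A)   ps sub = hyp (∈-map⁺ (literal w) (sub (here refl)))
  kalmar w (A ⇒ B) ps sub
    with sem w A | sem w B | kalmar w A ps (sub ∘ ∈-++⁺ˡ) | kalmar w B ps (sub ∘ ∈-++⁺ʳ (atoms A))
  ... | false | _     | ¬a | _  = deduction (ex-falso B (mp (weaken ¬a) (hyp (here refl))))
  ... | true  | true  | _  | b  = mp (thm (ax1 B A)) b
  ... | true  | false | a  | ¬b = ¬⇒-intro a ¬b

update : (ℕ → Bool) → ℕ → Bool → ℕ → Bool
update w k b m = if m ≡ᵇ k then b else w m

update-same : ∀ w k b → update w k b k ≡ b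
update-same w k b rewrite ≡ᵇ-refl k = refl

update-other : ∀ w k b m → m ≢ k → update w k b m ≡ w m
update-other w k b m m≢k with m ≡ᵇ k in eq
... | true  = ⊥-elim (m≢k (≡ᵇ-true eq))
... | false = refl

module _ {L : Logic} where

  private
    literal-update : ∀ w r b qs → ¬ r ∈ qs → map (literal (update w (code r) b)) qs ≡ map (literal w) qs
    literal-update w r b []       r∉ = refl
    literal-update w r b (q ∷ qs) r∉ =
      cong₂ _∷_ (cong (λ v → if v then q else ¬' q) (update-other w (code r) b (code q) (r∉ ∘ q≡r⇒r∈)))
                (literal-update w r b qs (r∉ ∘ there))
      where
      q≡r⇒r∈ : code q ≡ code r → r ∈ q ∷ qs
      q≡r⇒r∈ eq = here (sym (code-injective eq))

  -- Invariant: F holds under every valuation agreeing with w on the fixed atoms qs;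
  -- each remaining atom r is fixed both ways and the two derivations are merged by cases.
  eliminate-atoms : ∀ F rs qs w
    → (∀ w′ → (∀ {q} → q ∈ qs → w′ (code q) ≡ w (code q)) → sem w′ F ≡ true)
    → (∀ {x} → x ∈ atoms F → x ∈ qs ⊎ x ∈ rs)
    → L ∣ map (literal w) qs ⊢ F
  eliminate-atoms F [] qs w valid sub =
    subst (λ v → L ∣ map (literal w) qs ⊢ (if v then F else ¬' F)) (valid w (λ _ → refl))
          (kalmar w F qs (λ x∈ → [ id , (λ ()) ]′ (sub x∈)))
  eliminate-atoms F (r ∷ rs) qs w valid sub with any? (r ≟ᶠ_) qs
  ... | yes r∈ = eliminate-atoms F rs qs w valid
                   (λ x∈ → [ inj₁ , (λ { (here refl) → inj₁ r∈ ; (there p) → inj₂ p }) ]′ (sub x∈))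
  ... | no r∉  = by-cases (fix-r true) (fix-r false)
    where
    fix-r : ∀ b → L ∣ map (literal w) qs ⊢ ((if b then r else ¬' r) ⇒ F)
    fix-r b = deduction (subst₂ (λ l ls → L ∣ l ∷ ls ⊢ F)
      (cong (λ v → if v then r else ¬' r) (update-same w (code r) b))
      (literal-update w r b qs r∉)
      (eliminate-atoms F rs (r ∷ qs) (update w (code r) b)
        (λ w′ agree → valid w′ (λ {q} q∈ → trans (agree (there q∈))
                                  (update-other w (code r) b (code q) (λ eq → r∉ (subst (_∈ qs) (code-injective eq) q∈)))))
        (λ x∈ → [ inj₁ ∘ there , (λ { (here refl) → inj₁ (here refl) ; (there p) → inj₂ p }) ]′ (sub x∈))))

  tautology : ∀ F → (∀ w → sem w F ≡ true) → L ⊢ F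
  tautology F taut = discharge (eliminate-atoms F (atoms F) [] (λ _ → true) (λ w′ _ → taut w′) inj₂)

-- Reading □ as the identity and every variable as true validates all the axioms.
erase : Fm → Bool
erase (var n) = true
erase ⊥'      = false
erase (A ⇒ B) = erase A ⇒ᵇ erase B
erase (□ A)   = erase A

erase-sound : ∀ {L A} → L ⊢ A → erase A ≡ true
erase-sound (ax1 A B) with erase A | erase B
... | true  | true  = refl
... | true  | false = refl
... | false | _     = refl
erase-sound (ax2 A B C) with erase A | erase B | erase C
... | true  | true  | true  = refl
... | true  | true  | false = refl
... | true  | false | _     = refl
... | false | _     | _     = refl
erase-sound (ax3 A) with erase A
... | true  = refl
... | false = refl
erase-sound (extra P-NP)  = refl
erase-sound (extra P-NP4) = refl
erase-sound (extra (D-ND A))  with erase A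
... | true  = refl
... | false = refl
erase-sound (extra (D-ND4 A)) with erase A
... | true  = refl
... | false = refl
erase-sound (extra (4-ND4 A)) = ⇒ᵇ-intro {erase A} id
erase-sound (extra (4-NP4 A)) = ⇒ᵇ-intro {erase A} id
erase-sound (mp d e) = ⇒ᵇ-elim (erase-sound d) (erase-sound e)
erase-sound (nec d)  = erase-sound d

consistent : ∀ {L} → ¬ (L ⊢ ⊥')
consistent d with erase-sound d
... | ()

sem-∧ : ∀ w A B → sem w (A ∧' B) ≡ true → sem w A ≡ true × sem w B ≡ true
sem-∧ w A B e with sem w A | sem w B
... | true | true = refl , refl

sem-¬ : ∀ w A → sem w (¬' A) ≡ true → sem w A ≡ false
sem-¬ w A e with sem w A
... | false = refl

sem-¬∧-intro : ∀ w A B → (sem w A ≡ true → sem w B ≡ false) → sem w (¬' (A ∧' B)) ≡ true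
sem-¬∧-intro w A B h with sem w A | sem w B | h
... | true  | true  | h′ with () ← h′ refl
... | true  | false | _ = refl
... | false | _     | _ = refl

sem-¬∧-elim : ∀ w A B → sem w (¬' (A ∧' B)) ≡ true → sem w A ≡ true → sem w B ≡ false
sem-¬∧-elim w A B e a with sem w A | sem w B
... | true | false = refl

sem-¬-intro : ∀ w A → sem w A ≡ false → sem w (¬' A) ≡ true
sem-¬-intro w A e rewrite e = refl

⊤' : Fm
⊤' = ⊥' ⇒ ⊥'

when : Bool → Fm → Fm
when true  F = F
when false F = ⊤'

sem-when : ∀ w b F → sem w (when b F) ≡ true → b ≡ true → sem w F ≡ true
sem-when w true F e refl = e

⋀ : List Fm → Fm
⋀ []       = ⊤'
⋀ (G ∷ Gs) = G ∧' ⋀ Gs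

sem-⋀ : ∀ w Gs → sem w (⋀ Gs) ≡ true → All (λ G → sem w G ≡ true) Gs
sem-⋀ w []       _ = []
sem-⋀ w (G ∷ Gs) e = proj₁ (sem-∧ w G (⋀ Gs) e) ∷ sem-⋀ w Gs (proj₂ (sem-∧ w G (⋀ Gs) e))

module _ {L : Logic} where

  semantic-mp : ∀ {A B} → (∀ w → sem w A ≡ true → sem w B ≡ true) → L ⊢ A → L ⊢ B
  semantic-mp {A} {B} h = mp (tautology (A ⇒ B) (λ w → ⇒ᵇ-intro (h w)))

  semantic-mp₂ : ∀ {A B C} → (∀ w → sem w A ≡ true → sem w B ≡ true → sem w C ≡ true)
               → L ⊢ A → L ⊢ B → L ⊢ C
  semantic-mp₂ {A} {B} {C} h a = mp (semantic-mp (λ w a → ⇒ᵇ-intro (h w a)) a)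

  ⊤-intro : L ⊢ ⊤'
  ⊤-intro = tautology ⊤' (λ _ → refl)

  when-intro : ∀ b F → (b ≡ true → L ⊢ F) → L ⊢ when b F
  when-intro true  F d = d refl
  when-intro false F d = ⊤-intro

  ∧-intro : ∀ {A B} → L ⊢ A → L ⊢ B → L ⊢ (A ∧' B)
  ∧-intro {A} {B} = semantic-mp₂ both
    where
    both : ∀ w → sem w A ≡ true → sem w B ≡ true → sem w (A ∧' B) ≡ true
    both w a b rewrite a | b = refl

  ⋀-intro : ∀ {Gs} → All (L ⊢_) Gs → L ⊢ ⋀ Gs
  ⋀-intro []       = ⊤-intro
  ⋀-intro (d ∷ ds) = ∧-intro d (⋀-intro ds)

has4 hasD hasP : Logic → Bool
has4 ND4 = true
has4 NP4 = true
has4 _   = false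
hasD ND  = true
hasD ND4 = true
hasD _   = false
hasP NP  = true
hasP NP4 = true
hasP _   = false

hasD⇒¬hasP : ∀ L → hasD L ≡ true → hasP L ≡ false
hasD⇒¬hasP ND  _ = refl
hasD⇒¬hasP ND4 _ = refl

P-axiom : ∀ L → hasP L ≡ true → L ⊢ (¬' (□ ⊥'))
P-axiom NP  _ = extra P-NP
P-axiom NP4 _ = extra P-NP4

4-axiom : ∀ L X → has4 L ≡ true → L ⊢ ((□ X) ⇒ (□ (□ X)))
4-axiom ND4 X _ = extra (4-ND4 X)
4-axiom NP4 X _ = extra (4-NP4 X)

D-axiom : ∀ L X → hasD L ≡ true → L ⊢ (¬' ((□ X) ∧' (□ (¬' X))))
D-axiom ND  X _ = extra (D-ND X)
D-axiom ND4 X _ = extra (D-ND4 X)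

D4-theorem : ∀ L X → hasD L ≡ true → has4 L ≡ true → L ⊢ (¬' ((□ X) ∧' (□ (¬' (□ X)))))
D4-theorem ND4 X _ _ = semantic-mp₂ chain (4-axiom ND4 X refl) (D-axiom ND4 (□ X) refl)
  where
  chain : ∀ w → sem w ((□ X) ⇒ (□ (□ X))) ≡ true → sem w (¬' ((□ (□ X)) ∧' (□ (¬' (□ X))))) ≡ true
        → sem w (¬' ((□ X) ∧' (□ (¬' (□ X))))) ≡ true
  chain w four d = sem-¬∧-intro w (□ X) (□ (¬' (□ X)))
    (sem-¬∧-elim w (□ (□ X)) (□ (¬' (□ X))) d ∘ ⇒ᵇ-elim four)

module _ {L : Logic} {X : Fm} (D : hasD L ≡ true) where

  □¬⇒¬□ : L ⊢ (□ (¬' X)) → L ⊢ (¬' (□ X))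
  □¬⇒¬□ d = semantic-mp₂ refute d (D-axiom L X D)
    where
    refute : ∀ w → sem w (□ (¬' X)) ≡ true → sem w (¬' ((□ X) ∧' (□ (¬' X)))) ≡ true → sem w (¬' (□ X)) ≡ true
    refute w b¬x ax = sem-¬-intro w (□ X) (contraposeᵇ (sem-¬∧-elim w (□ X) (□ (¬' X)) ax) b¬x)

  □⇒¬□¬ : L ⊢ (□ X) → L ⊢ (¬' (□ (¬' X)))
  □⇒¬□¬ d = semantic-mp₂ (λ w bx ax → sem-¬-intro w (□ (¬' X)) (sem-¬∧-elim w (□ X) (□ (¬' X)) ax bx))
                          d (D-axiom L X D)

record PrimRec (n : ℕ) (f : Vec ℕ n → ℕ) : Set where
  constructor mkPrimRec
  field
    program      : PR n
    program-eval : ∀ xs → eval program xs ≡ f xs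
open PrimRec public

-- Stated through an equation so that a program hidden behind an opaque name is never unfolded.
eval-≡-program : ∀ {k f} (p : PrimRec k f) c → c ≡ program p → ∀ xs → eval c xs ≡ f xs
eval-≡-program p .(program p) refl = program-eval p

data PrimRecs (n : ℕ) : (k : ℕ) → (Vec ℕ n → Vec ℕ k) → Set where
  []  : PrimRecs n 0 (λ _ → [])
  _∷_ : ∀ {k g gs} → PrimRec n g → PrimRecs n k gs → PrimRecs n (suc k) (λ xs → g xs ∷ gs xs)

programs : ∀ {n k gs} → PrimRecs n k gs → Vec (PR n) k
programs []       = []
programs (p ∷ ps) = program p ∷ programs ps

programs-evalAll : ∀ {n k gs} (ps : PrimRecs n k gs) xs → evalAll (programs ps) xs ≡ gs xs
programs-evalAll []       xs = refl
programs-evalAll (p ∷ ps) xs = cong₂ _∷_ (program-eval p xs) (programs-evalAll ps xs)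

compose-pr : ∀ {n k f gs} → PrimRec k f → PrimRecs n k gs → PrimRec n (λ xs → f (gs xs))
compose-pr {f = f} p ps =
  mkPrimRec (comp (program p) (programs ps)) (λ xs → trans (program-eval p _) (cong f (programs-evalAll ps xs)))

recursion : ∀ {n} → (Vec ℕ n → ℕ) → (Vec ℕ (suc (suc n)) → ℕ) → Vec ℕ (suc n) → ℕ
recursion g h (zero  ∷ xs) = g xs
recursion g h (suc m ∷ xs) = h (m ∷ recursion g h (m ∷ xs) ∷ xs)

recursion-pr : ∀ {n g h} → PrimRec n g → PrimRec (suc (suc n)) h → PrimRec (suc n) (recursion g h)
recursion-pr {g = g} {h} pg ph = mkPrimRec (rec (program pg) (program ph)) correct
  where
  correct : ∀ xs → eval (rec (program pg) (program ph)) xs ≡ recursion g h xs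
  correct (zero  ∷ xs) = program-eval pg xs
  correct (suc m ∷ xs) rewrite correct (m ∷ xs) = program-eval ph _

ext-pr : ∀ {n f g} → (∀ xs → f xs ≡ g xs) → PrimRec n f → PrimRec n g
ext-pr f≗g p = mkPrimRec (program p) (λ xs → trans (program-eval p xs) (f≗g xs))

PrimRec₁ : (ℕ → ℕ) → Set
PrimRec₁ f = PrimRec 1 (_$ⁿ_ {n = 1} f)

PrimRec₂ : (ℕ → ℕ → ℕ) → Set
PrimRec₂ f = PrimRec 2 (_$ⁿ_ {n = 2} f)

PrimRec₃ : (ℕ → ℕ → ℕ → ℕ) → Set
PrimRec₃ f = PrimRec 3 (_$ⁿ_ {n = 3} f)

module _ {n : ℕ} where

  app₁ : ∀ {f a} → PrimRec₁ f → PrimRec n a → PrimRec n (λ xs → f (a xs))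
  app₁ p a = compose-pr p (a ∷ [])

  app₂ : ∀ {f a b} → PrimRec₂ f → PrimRec n a → PrimRec n b → PrimRec n (λ xs → f (a xs) (b xs))
  app₂ p a b = compose-pr p (a ∷ b ∷ [])

  app₃ : ∀ {f a b c} → PrimRec₃ f → PrimRec n a → PrimRec n b → PrimRec n c
       → PrimRec n (λ xs → f (a xs) (b xs) (c xs))
  app₃ p a b c = compose-pr p (a ∷ b ∷ c ∷ [])

  zero-pr : PrimRec n (λ _ → 0)
  zero-pr = mkPrimRec zer (λ _ → refl)

  proj-pr : ∀ i → PrimRec n (λ xs → lookup xs i)
  proj-pr i = mkPrimRec (proj i) (λ _ → refl)

suc-pr : PrimRec₁ suc
suc-pr = mkPrimRec succ (λ { (x ∷ []) → refl })

const-pr : ∀ {n} k → PrimRec n (λ _ → k)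
const-pr zero    = zero-pr
const-pr (suc k) = app₁ suc-pr (const-pr k)

+-pr : PrimRec₂ _+_
+-pr = ext-pr correct (recursion-pr (proj-pr (# 0)) (app₁ suc-pr (proj-pr (# 1))))
  where
  correct : ∀ xs → recursion (λ xs → lookup xs (# 0)) (λ xs → suc (lookup xs (# 1))) xs ≡ _$ⁿ_ {n = 2} _+_ xs
  correct (zero  ∷ y ∷ []) = refl
  correct (suc x ∷ y ∷ []) = cong suc (correct (x ∷ y ∷ []))

*-pr : PrimRec₂ _*_
*-pr = ext-pr correct (recursion-pr zero-pr (app₂ +-pr (proj-pr (# 2)) (proj-pr (# 1))))
  where
  correct : ∀ xs → recursion (λ _ → 0) (λ xs → lookup xs (# 2) + lookup xs (# 1)) xs ≡ _$ⁿ_ {n = 2} _*_ xs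
  correct (zero  ∷ y ∷ []) = refl
  correct (suc x ∷ y ∷ []) = cong (y +_) (correct (x ∷ y ∷ []))

pred-pr : PrimRec₁ pred
pred-pr = ext-pr (λ { (zero ∷ []) → refl ; (suc x ∷ []) → refl }) (recursion-pr zero-pr (proj-pr (# 0)))

∸-pr : PrimRec₂ _∸_
∸-pr = ext-pr (λ { (x ∷ y ∷ []) → correct y x }) (compose-pr flipped (proj-pr (# 1) ∷ proj-pr (# 0) ∷ []))
  where
  flipped = recursion-pr (proj-pr (# 0)) (app₁ pred-pr (proj-pr (# 1)))
  correct : ∀ y x → recursion (λ xs → lookup xs (# 0)) (λ xs → pred (lookup xs (# 1))) (y ∷ x ∷ []) ≡ x ∸ y
  correct zero    x = refl
  correct (suc y) x = trans (cong pred (correct y x)) (pred[m∸n]≡m∸[1+n] x y)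

fromBool : Bool → ℕ
fromBool true  = 1
fromBool false = 0

isNonZero : ℕ → Bool
isNonZero n = not (n ≡ᵇ 0)

isNonZero-fromBool : ∀ b → isNonZero (fromBool b) ≡ b
isNonZero-fromBool true  = refl
isNonZero-fromBool false = refl

PrimRecPred : (n : ℕ) → (Vec ℕ n → Bool) → Set
PrimRecPred n P = PrimRec n (λ xs → fromBool (P xs))

PrimRecPred₂ : (ℕ → ℕ → Bool) → Set
PrimRecPred₂ P = PrimRecPred 2 (_$ⁿ_ {n = 2} P)

module _ {n : ℕ} where

  appᵇ₂ : ∀ {P a b} → PrimRecPred₂ P → PrimRec n a → PrimRec n b → PrimRecPred n (λ xs → P (a xs) (b xs))
  appᵇ₂ p a b = compose-pr p (a ∷ b ∷ [])

  constᵇ-pr : ∀ b → PrimRecPred n (λ _ → b)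
  constᵇ-pr b = const-pr (fromBool b)

  ∧-pr : ∀ {P Q} → PrimRecPred n P → PrimRecPred n Q → PrimRecPred n (λ xs → P xs ∧ Q xs)
  ∧-pr {P = P} {Q} p q = ext-pr (λ xs → correct (P xs) (Q xs)) (app₂ *-pr p q)
    where
    correct : ∀ a b → fromBool a * fromBool b ≡ fromBool (a ∧ b)
    correct true  true  = refl
    correct true  false = refl
    correct false b     = refl

  not-pr : ∀ {P} → PrimRecPred n P → PrimRecPred n (λ xs → not (P xs))
  not-pr {P = P} p = ext-pr (λ xs → correct (P xs)) (app₂ ∸-pr (const-pr 1) p)
    where
    correct : ∀ a → 1 ∸ fromBool a ≡ fromBool (not a)
    correct true  = refl
    correct false = refl

  ∨-pr : ∀ {P Q} → PrimRecPred n P → PrimRecPred n Q → PrimRecPred n (λ xs → P xs ∨ Q xs)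
  ∨-pr {P = P} {Q} p q = ext-pr (λ xs → cong fromBool (correct (P xs) (Q xs))) (not-pr (∧-pr (not-pr p) (not-pr q)))
    where
    correct : ∀ a b → not (not a ∧ not b) ≡ (a ∨ b)
    correct true  b     = refl
    correct false true  = refl
    correct false false = refl

  ⇒ᵇ-pr : ∀ {P Q} → PrimRecPred n P → PrimRecPred n Q → PrimRecPred n (λ xs → P xs ⇒ᵇ Q xs)
  ⇒ᵇ-pr p q = ∨-pr (not-pr p) q

  private
    1∸-fromBool : ∀ m → 1 ∸ m ≡ fromBool (m ≡ᵇ 0)
    1∸-fromBool zero          = refl
    1∸-fromBool (suc zero)    = refl
    1∸-fromBool (suc (suc m)) = refl

    m∸k+k∸m≡ᵇ0≡m≡ᵇk : ∀ m k → ((m ∸ k) + (k ∸ m) ≡ᵇ 0) ≡ (m ≡ᵇ k)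
    m∸k+k∸m≡ᵇ0≡m≡ᵇk zero    zero    = refl
    m∸k+k∸m≡ᵇ0≡m≡ᵇk zero    (suc k) = refl
    m∸k+k∸m≡ᵇ0≡m≡ᵇk (suc m) zero    = refl
    m∸k+k∸m≡ᵇ0≡m≡ᵇk (suc m) (suc k) = m∸k+k∸m≡ᵇ0≡m≡ᵇk m k

    m∸k≡ᵇ0≡m≤ᵇk : ∀ m k → (m ∸ k ≡ᵇ 0) ≡ (m ≤ᵇ k)
    m∸k≡ᵇ0≡m≤ᵇk zero    zero    = refl
    m∸k≡ᵇ0≡m≤ᵇk zero    (suc k) = refl
    m∸k≡ᵇ0≡m≤ᵇk (suc m) zero    = refl
    m∸k≡ᵇ0≡m≤ᵇk (suc m) (suc k) = trans (m∸k≡ᵇ0≡m≤ᵇk m k) (≤ᵇ-suc m k)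
      where
      ≤ᵇ-suc : ∀ m k → (m ≤ᵇ k) ≡ (suc m ≤ᵇ suc k)
      ≤ᵇ-suc zero    k = refl
      ≤ᵇ-suc (suc m) k = refl

  ≡ᵇ-pr : ∀ {f g} → PrimRec n f → PrimRec n g → PrimRecPred n (λ xs → f xs ≡ᵇ g xs)
  ≡ᵇ-pr {f} {g} p q =
    ext-pr (λ xs → trans (1∸-fromBool ((f xs ∸ g xs) + (g xs ∸ f xs)))
                         (cong fromBool (m∸k+k∸m≡ᵇ0≡m≡ᵇk (f xs) (g xs))))
           (app₂ ∸-pr (const-pr 1) (app₂ +-pr (app₂ ∸-pr p q) (app₂ ∸-pr q p)))

  ≤ᵇ-pr : ∀ {f g} → PrimRec n f → PrimRec n g → PrimRecPred n (λ xs → f xs ≤ᵇ g xs)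
  ≤ᵇ-pr {f} {g} p q =
    ext-pr (λ xs → trans (1∸-fromBool (f xs ∸ g xs)) (cong fromBool (m∸k≡ᵇ0≡m≤ᵇk (f xs) (g xs))))
           (app₂ ∸-pr (const-pr 1) (app₂ ∸-pr p q))

  isNonZero-pr : ∀ {f} → PrimRec n f → PrimRecPred n (λ xs → isNonZero (f xs))
  isNonZero-pr p = not-pr (≡ᵇ-pr p zero-pr)

  if-pr : ∀ {P f g} → PrimRecPred n P → PrimRec n f → PrimRec n g
        → PrimRec n (λ xs → if P xs then f xs else g xs)
  if-pr {P = P} {f} {g} p pf pg =
    ext-pr (λ xs → correct (P xs) (f xs) (g xs)) (app₂ +-pr (app₂ *-pr p pf) (app₂ *-pr (not-pr p) pg))
    where
    correct : ∀ b x y → fromBool b * x + fromBool (not b) * y ≡ (if b then x else y)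
    correct true  x y = trans (+-identityʳ (x + 0)) (+-identityʳ x)
    correct false x y = +-identityʳ y

projections : ∀ {n k} (f : Fin k → Fin n) → PrimRecs n k (λ xs → tabulate (λ i → lookup xs (f i)))
projections {k = zero}  f = []
projections {k = suc k} f = proj-pr (f Fin.zero) ∷ projections (f ∘ Fin.suc)

module _ {n : ℕ} where

  substitute-pr : ∀ {f a} → PrimRec (suc n) f → PrimRec n a → PrimRec n (λ xs → f (a xs ∷ xs))
  substitute-pr {f} {a} p pa = ext-pr (λ xs → cong (λ ys → f (a xs ∷ ys)) (tabulate∘lookup xs))
                                      (compose-pr p (pa ∷ projections id))

  substitute₂-pr : ∀ {f a b} → PrimRec (suc (suc n)) f → PrimRec n a → PrimRec n b
                 → PrimRec n (λ xs → f (a xs ∷ b xs ∷ xs))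
  substitute₂-pr {f} {a} {b} p pa pb = ext-pr (λ xs → cong (λ ys → f (a xs ∷ b xs ∷ ys)) (tabulate∘lookup xs))
                                              (compose-pr p (pa ∷ pb ∷ projections id))

tri-pr : PrimRec₁ tri
tri-pr = ext-pr correct (recursion-pr zero-pr (app₂ +-pr (app₁ suc-pr (proj-pr (# 0))) (proj-pr (# 1))))
  where
  correct : ∀ xs → recursion (λ _ → 0) (λ xs → suc (lookup xs (# 0)) + lookup xs (# 1)) xs ≡ _$ⁿ_ {n = 1} tri xs
  correct (zero  ∷ []) = refl
  correct (suc x ∷ []) = cong (suc x +_) (correct (x ∷ []))

pair-pr : PrimRec₂ pair
pair-pr = ext-pr (λ { (a ∷ b ∷ []) → refl })
  (app₂ +-pr (app₁ tri-pr (app₂ +-pr (proj-pr (# 0)) (proj-pr (# 1)))) (proj-pr (# 1)))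

opaque
  unfolding triRoot

  triRoot-pr : PrimRec₁ triRoot
  triRoot-pr = ext-pr correct (recursion-pr zero-pr step)
    where
    step : PrimRec 2 (λ xs → if tri (suc (lookup xs (# 1))) ≤ᵇ suc (lookup xs (# 0))
                             then suc (lookup xs (# 1)) else lookup xs (# 1))
    step = if-pr (≤ᵇ-pr (app₁ tri-pr (app₁ suc-pr (proj-pr (# 1)))) (app₁ suc-pr (proj-pr (# 0))))
                 (app₁ suc-pr (proj-pr (# 1))) (proj-pr (# 1))
    correct : ∀ xs → recursion (λ _ → 0)
      (λ xs → if tri (suc (lookup xs (# 1))) ≤ᵇ suc (lookup xs (# 0)) then suc (lookup xs (# 1)) else lookup xs (# 1)) xs
      ≡ _$ⁿ_ {n = 1} triRoot xs
    correct (zero  ∷ []) = refl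
    correct (suc x ∷ []) rewrite correct (x ∷ []) = refl

unpair₂-pr : PrimRec₁ unpair₂
unpair₂-pr = ext-pr (λ { (x ∷ []) → refl }) (app₂ ∸-pr (proj-pr (# 0)) (app₁ tri-pr (app₁ triRoot-pr (proj-pr (# 0)))))

unpair₁-pr : PrimRec₁ unpair₁
unpair₁-pr = ext-pr (λ { (x ∷ []) → refl })
  (app₂ ∸-pr (app₁ triRoot-pr (proj-pr (# 0))) (app₁ unpair₂-pr (proj-pr (# 0))))

-- Finite sequences are coded as nested pairs pair s₀ (pair s₁ (… 0)).
dropEntries : ℕ → ℕ → ℕ
dropEntries zero    s = s
dropEntries (suc k) s = unpair₂ (dropEntries k s)

entry : ℕ → ℕ → ℕ
entry k s = unpair₁ (dropEntries k s)

dropEntries-suc′ : ∀ k s → dropEntries (suc k) s ≡ dropEntries k (unpair₂ s)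
dropEntries-suc′ zero    s = refl
dropEntries-suc′ (suc k) s = cong unpair₂ (dropEntries-suc′ k s)

entry-zero : ∀ a s → entry 0 (pair a s) ≡ a
entry-zero = unpair₁-pair

entry-suc : ∀ k a s → entry (suc k) (pair a s) ≡ entry k s
entry-suc k a s = cong unpair₁ (trans (dropEntries-suc′ k (pair a s)) (cong (dropEntries k) (unpair₂-pair a s)))

dropEntries-pr : PrimRec₂ dropEntries
dropEntries-pr = ext-pr correct (recursion-pr (proj-pr (# 0)) (app₁ unpair₂-pr (proj-pr (# 1))))
  where
  correct : ∀ xs → recursion (λ xs → lookup xs (# 0)) (λ xs → unpair₂ (lookup xs (# 1))) xs ≡ _$ⁿ_ {n = 2} dropEntries xs
  correct (zero  ∷ s ∷ []) = refl
  correct (suc k ∷ s ∷ []) = cong unpair₂ (correct (k ∷ s ∷ []))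

entry-pr : PrimRec₂ entry
entry-pr = ext-pr (λ { (k ∷ s ∷ []) → refl }) (app₁ unpair₁-pr dropEntries-pr)

-- Course-of-values recursion with one parameter x: the history at n lists
-- the values at n - 1, …, 0, most recent first.
cvHistory : (ℕ → ℕ → ℕ → ℕ) → ℕ → ℕ → ℕ
cvHistory G zero    x = 0
cvHistory G (suc n) x = pair (G n (cvHistory G n x) x) (cvHistory G n x)

cvValue : (ℕ → ℕ → ℕ → ℕ) → ℕ → ℕ → ℕ
cvValue G n x = G n (cvHistory G n x) x

cvLookup : ℕ → ℕ → ℕ → ℕ
cvLookup n h k = entry (n ∸ suc k) h

cvLookup-history : ∀ G {n x k} → k < n → cvLookup n (cvHistory G n x) k ≡ cvValue G k x
cvLookup-history G {suc n} {x} {k} (s≤s k≤n) with m≤n⇒m<n∨m≡n k≤n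
... | inj₂ refl rewrite n∸n≡0 k = entry-zero (G n (cvHistory G n x) x) (cvHistory G n x)
... | inj₁ k<n rewrite +-∸-assoc 1 k<n =
  trans (entry-suc (n ∸ suc k) (G n (cvHistory G n x) x) (cvHistory G n x)) (cvLookup-history G k<n)

cvLookup-pr : PrimRec₃ cvLookup
cvLookup-pr = ext-pr (λ { (n ∷ h ∷ k ∷ []) → refl })
  (app₂ entry-pr (app₂ ∸-pr (proj-pr (# 0)) (app₁ suc-pr (proj-pr (# 2)))) (proj-pr (# 1)))

cvValue-pr : ∀ {G} → PrimRec₃ G → PrimRec₂ (cvValue G)
cvValue-pr {G} pG = ext-pr (λ { (n ∷ x ∷ []) → refl }) (app₃ pG (proj-pr (# 0)) history-pr (proj-pr (# 1)))
  where
  history-pr : PrimRec 2 (_$ⁿ_ {n = 2} (cvHistory G))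
  history-pr = ext-pr correct
    (recursion-pr zero-pr (app₂ pair-pr (app₃ pG (proj-pr (# 0)) (proj-pr (# 1)) (proj-pr (# 2))) (proj-pr (# 1))))
    where
    correct : ∀ xs → recursion (λ _ → 0)
                       (λ xs → pair (G (lookup xs (# 0)) (lookup xs (# 1)) (lookup xs (# 2))) (lookup xs (# 1))) xs
                    ≡ _$ⁿ_ {n = 2} (cvHistory G) xs
    correct (zero  ∷ x ∷ []) = refl
    correct (suc n ∷ x ∷ []) rewrite correct (n ∷ x ∷ []) = refl

-- Opaque so that a quantifier over a bound of the form suc n is not unrolled.
opaque
  all≤ : ℕ → (ℕ → Bool) → Bool
  all≤ zero    P = P 0
  all≤ (suc n) P = all≤ n P ∧ P (suc n)

  all≤-elim : ∀ n P → all≤ n P ≡ true → ∀ i → i ≤ n → P i ≡ true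
  all≤-elim zero    P h .0 z≤n = h
  all≤-elim (suc n) P h i i≤1+n with m≤n⇒m<n∨m≡n i≤1+n
  ... | inj₁ (s≤s i≤n) = all≤-elim n P (∧-conicalˡ _ _ h) i i≤n
  ... | inj₂ refl      = ∧-conicalʳ _ _ h

  all≤-intro : ∀ n P → (∀ i → i ≤ n → P i ≡ true) → all≤ n P ≡ true
  all≤-intro zero    P h = h 0 z≤n
  all≤-intro (suc n) P h rewrite all≤-intro n P (λ i i≤n → h i (m≤n⇒m≤1+n i≤n)) = h (suc n) ≤-refl

  all≤-false : ∀ n P → all≤ n P ≡ false → Σ[ i ∈ ℕ ] i ≤ n × P i ≡ false
  all≤-false zero    P h = 0 , z≤n , h
  all≤-false (suc n) P h with all≤ n P in e
  ... | false = let i , i≤n , Pi = all≤-false n P e in i , m≤n⇒m≤1+n i≤n , Pi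
  ... | true  = suc n , ≤-refl , h

  all≤-pr : ∀ {n P} → PrimRecPred (suc n) P → PrimRecPred (suc n) (λ xs → all≤ (head xs) (λ i → P (i ∷ tail xs)))
  all≤-pr {n} {P} p = ext-pr correct (recursion-pr (substitute-pr p zero-pr) step)
    where
    step : PrimRecPred (suc (suc n)) (λ ys → isNonZero (lookup ys (# 1)) ∧ P (suc (head ys) ∷ tail (tail ys)))
    step = ∧-pr (isNonZero-pr (proj-pr (# 1)))
      (ext-pr (λ { (k ∷ acc ∷ xs) → cong (λ zs → fromBool (P (suc k ∷ zs))) (tabulate∘lookup xs) })
              (compose-pr p (app₁ suc-pr (proj-pr (# 0)) ∷ projections (Fin.suc ∘ Fin.suc))))
    correct : ∀ xs → recursion (λ xs → fromBool (P (0 ∷ xs)))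
                       (λ ys → fromBool (isNonZero (lookup ys (# 1)) ∧ P (suc (head ys) ∷ tail (tail ys)))) xs
                   ≡ fromBool (all≤ (head xs) (λ i → P (i ∷ tail xs)))
    correct (zero  ∷ xs) = refl
    correct (suc k ∷ xs) rewrite correct (k ∷ xs) | isNonZero-fromBool (all≤ k (λ i → P (i ∷ xs))) = refl

module _ {n : ℕ} {t : Vec ℕ n → ℕ} {V : Vec ℕ (suc n) → ℕ} {B : Vec ℕ n → ℕ}
         {I : Vec ℕ (suc (suc n)) → ℕ} {X : Vec ℕ (suc n) → ℕ} where

  caseCode-pr : PrimRec n t → PrimRec (suc n) V → PrimRec n B → PrimRec (suc (suc n)) I → PrimRec (suc n) X
    → PrimRec n (λ xs → caseCode (t xs) (λ a → V (a ∷ xs)) (B xs) (λ a b → I (a ∷ b ∷ xs)) (λ a → X (a ∷ xs)))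
  caseCode-pr pt pV pB pI pX = ext-pr (λ xs → sym (caseCode-if (t xs) _ _ _ _))
    (if-pr (≡ᵇ-pr tag (const-pr 0)) (substitute-pr pV body)
    (if-pr (≡ᵇ-pr tag (const-pr 2)) (substitute₂-pr pI (app₁ unpair₁-pr body) (app₁ unpair₂-pr body))
    (if-pr (≡ᵇ-pr tag (const-pr 3)) (substitute-pr pX body) pB)))
    where
    tag  = app₁ unpair₁-pr pt
    body = app₁ unpair₂-pr pt

module _ {n : ℕ} {t : Vec ℕ n → ℕ} {V : Vec ℕ (suc n) → Bool} {B : Vec ℕ n → Bool}
         {I : Vec ℕ (suc (suc n)) → Bool} {X : Vec ℕ (suc n) → Bool} where

  caseCodeᵇ-pr : PrimRec n t → PrimRecPred (suc n) V → PrimRecPred n B → PrimRecPred (suc (suc n)) I → PrimRecPred (suc n) X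
    → PrimRecPred n (λ xs → caseCode (t xs) (λ a → V (a ∷ xs)) (B xs) (λ a b → I (a ∷ b ∷ xs)) (λ a → X (a ∷ xs)))
  caseCodeᵇ-pr pt pV pB pI pX = ext-pr (λ xs → sym (caseCode-map fromBool (t xs) _ _ _ _)) (caseCode-pr pt pV pB pI pX)

valuationOf : ℕ → ℕ → Bool
valuationOf s m = isNonZero (entry m s)

encode : (ℕ → Bool) → ℕ → ℕ
encode w zero    = 0
encode w (suc k) = pair (fromBool (w 0)) (encode (w ∘ suc) k)

valuationOf-encode : ∀ w k m → m < k → valuationOf (encode w k) m ≡ w m
valuationOf-encode w (suc k) zero    _ =
  trans (cong isNonZero (entry-zero (fromBool (w 0)) (encode (w ∘ suc) k))) (isNonZero-fromBool (w 0))
valuationOf-encode w (suc k) (suc m) (s≤s m<k) =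
  trans (cong isNonZero (entry-suc m (fromBool (w 0)) (encode (w ∘ suc) k))) (valuationOf-encode (w ∘ suc) k m m<k)

encodingBound : ℕ → ℕ
encodingBound zero    = 0
encodingBound (suc k) = pair 1 (encodingBound k)

encode-≤ : ∀ w k → encode w k ≤ encodingBound k
encode-≤ w zero    = z≤n
encode-≤ w (suc k) = pair-mono-≤ (fromBool≤1 (w 0)) (encode-≤ (w ∘ suc) k)
  where
  fromBool≤1 : ∀ b → fromBool b ≤ 1
  fromBool≤1 true  = s≤s z≤n
  fromBool≤1 false = z≤n

encodingBound-pr : PrimRec₁ encodingBound
encodingBound-pr = ext-pr correct (recursion-pr zero-pr (app₂ pair-pr (const-pr 1) (proj-pr (# 1))))
  where
  correct : ∀ xs → recursion (λ _ → 0) (λ xs → pair 1 (lookup xs (# 1))) xs ≡ _$ⁿ_ {n = 1} encodingBound xs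
  correct (zero  ∷ []) = refl
  correct (suc k ∷ []) = cong (pair 1) (correct (k ∷ []))

valuationOf-pr : PrimRecPred₂ valuationOf
valuationOf-pr = ext-pr (λ { (s ∷ m ∷ []) → refl }) (isNonZero-pr (app₂ entry-pr (proj-pr (# 1)) (proj-pr (# 0))))

evalStep : ℕ → ℕ → ℕ → ℕ
evalStep n h s = fromBool (caseCode n
  (λ _ → valuationOf s n)
  false
  (λ a b → isNonZero (cvLookup n h a) ⇒ᵇ isNonZero (cvLookup n h b))
  (λ _ → valuationOf s n))

evalCode : ℕ → ℕ → Bool
evalCode n s = isNonZero (cvValue evalStep n s)

evalCode-code : ∀ A s → evalCode (code A) s ≡ sem (valuationOf s) A
evalCode-code A s = trans (isNonZero-fromBool _) (step A)
  where
  step : ∀ A → caseCode (code A) (λ _ → valuationOf s (code A)) false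
               (λ a b → isNonZero (cvLookup (code A) (cvHistory evalStep (code A) s) a)
                     ⇒ᵇ isNonZero (cvLookup (code A) (cvHistory evalStep (code A) s) b))
               (λ _ → valuationOf s (code A))
             ≡ sem (valuationOf s) A
  step (var k) = caseCode-var k
  step ⊥'      = caseCode-⊥
  step (B ⇒ C) = trans (caseCode-⇒ B C) (cong₂ _⇒ᵇ_
    (trans (cong isNonZero (cvLookup-history evalStep (code-<-⇒ˡ B C))) (evalCode-code B s))
    (trans (cong isNonZero (cvLookup-history evalStep (code-<-⇒ʳ B C))) (evalCode-code C s)))
  step (□ B)   = caseCode-□ B

evalCode-pr : PrimRecPred₂ evalCode
evalCode-pr = ext-pr (λ { (n ∷ s ∷ []) → refl }) (isNonZero-pr (cvValue-pr step-pr))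
  where
  atom = appᵇ₂ valuationOf-pr (proj-pr (# 3)) (proj-pr (# 1))
  lookupAt = λ i → isNonZero-pr (app₃ cvLookup-pr (proj-pr (# 2)) (proj-pr (# 3)) (proj-pr i))
  step-pr : PrimRec₃ evalStep
  step-pr = ext-pr (λ { (n ∷ h ∷ s ∷ []) → refl })
    (caseCodeᵇ-pr (proj-pr (# 0)) atom (constᵇ-pr false) (⇒ᵇ-pr (lookupAt (# 0)) (lookupAt (# 1))) atom)

subStep : ℕ → ℕ → ℕ → ℕ
subStep n h m = fromBool ((m ≡ᵇ n) ∨ caseCode n
  (λ _ → false)
  false
  (λ a b → isNonZero (cvLookup n h a) ∨ isNonZero (cvLookup n h b))
  (λ a → isNonZero (cvLookup n h a)))

opaque
  isSubCode : ℕ → ℕ → Bool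
  isSubCode n m = isNonZero (cvValue subStep n m)

  isSubCode-pr : PrimRecPred₂ isSubCode
  isSubCode-pr = ext-pr (λ { (n ∷ m ∷ []) → refl }) (isNonZero-pr (cvValue-pr step-pr))
    where
    lookupAt : ∀ i → PrimRecPred 5 (λ ys → isNonZero (cvLookup (lookup ys (# 2)) (lookup ys (# 3)) (lookup ys i)))
    lookupAt i = isNonZero-pr (app₃ cvLookup-pr (proj-pr (# 2)) (proj-pr (# 3)) (proj-pr i))
    step-pr : PrimRec₃ subStep
    step-pr = ext-pr (λ { (n ∷ h ∷ m ∷ []) → refl })
      (∨-pr (≡ᵇ-pr (proj-pr (# 2)) (proj-pr (# 0)))
            (caseCodeᵇ-pr (proj-pr (# 0)) (constᵇ-pr false) (constᵇ-pr false)
                          (∨-pr (lookupAt (# 0)) (lookupAt (# 1)))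
                          (isNonZero-pr (app₃ cvLookup-pr (proj-pr (# 1)) (proj-pr (# 2)) (proj-pr (# 0))))))

properSubCode : ℕ → Fm → Bool
properSubCode m (var k) = false
properSubCode m ⊥'      = false
properSubCode m (B ⇒ C) = isSubCode (code B) m ∨ isSubCode (code C) m
properSubCode m (□ B)   = isSubCode (code B) m

opaque
  unfolding isSubCode

  isSubCode-unfold : ∀ A m → isSubCode (code A) m ≡ ((m ≡ᵇ code A) ∨ properSubCode m A)
  isSubCode-unfold A m = trans (isNonZero-fromBool _) (cong ((m ≡ᵇ code A) ∨_) (step A))
    where
    step : ∀ A → caseCode (code A) (λ _ → false) false
                   (λ a b → isNonZero (cvLookup (code A) (cvHistory subStep (code A) m) a)
                          ∨ isNonZero (cvLookup (code A) (cvHistory subStep (code A) m) b))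
                   (λ a → isNonZero (cvLookup (code A) (cvHistory subStep (code A) m) a))
               ≡ properSubCode m A
    step (var k) = caseCode-var k
    step ⊥'      = caseCode-⊥
    step (B ⇒ C) = trans (caseCode-⇒ B C) (cong₂ _∨_
      (cong isNonZero (cvLookup-history subStep {x = m} (code-<-⇒ˡ B C)))
      (cong isNonZero (cvLookup-history subStep {x = m} (code-<-⇒ʳ B C))))
    step (□ B)   = trans (caseCode-□ B) (cong isNonZero (cvLookup-history subStep {x = m} (code-<-□ B)))

infix 4 _⊑ᵇ_
_⊑ᵇ_ : Fm → Fm → Bool
Y ⊑ᵇ A = isSubCode (code A) (code Y)

⊑ᵇ-complete : ∀ {Y A} → Y ⊑ A → (Y ⊑ᵇ A) ≡ true
⊑ᵇ-complete {Y} {A} ⊑-refl = trans (isSubCode-unfold A (code A)) (∨-introˡ _ (≡ᵇ-refl (code A)))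
⊑ᵇ-complete {Y} {B ⇒ C} (⊑-⇒ˡ p) = trans (isSubCode-unfold (B ⇒ C) (code Y))
  (∨-introʳ (code Y ≡ᵇ code (B ⇒ C)) (∨-introˡ (isSubCode (code C) (code Y)) (⊑ᵇ-complete p)))
⊑ᵇ-complete {Y} {B ⇒ C} (⊑-⇒ʳ p) = trans (isSubCode-unfold (B ⇒ C) (code Y))
  (∨-introʳ (code Y ≡ᵇ code (B ⇒ C)) (∨-introʳ (isSubCode (code B) (code Y)) (⊑ᵇ-complete p)))
⊑ᵇ-complete {Y} {□ B}   (⊑-□ p)  = trans (isSubCode-unfold (□ B) (code Y))
  (∨-introʳ (code Y ≡ᵇ code (□ B)) (⊑ᵇ-complete p))

isSubCode-sound : ∀ A m → isSubCode (code A) m ≡ true → Σ[ Y ∈ Fm ] Y ⊑ A × code Y ≡ m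
isSubCode-sound A m e rewrite isSubCode-unfold A m with m ≡ᵇ code A in eq
... | true = A , ⊑-refl , sym (≡ᵇ-true eq)
isSubCode-sound (B ⇒ C) m e | false with isSubCode (code B) m in eB
... | true  = let Y , p , q = isSubCode-sound B m eB in Y , ⊑-⇒ˡ p , q
... | false = let Y , p , q = isSubCode-sound C m e  in Y , ⊑-⇒ʳ p , q
isSubCode-sound (□ B) m e | false = let Y , p , q = isSubCode-sound B m e in Y , ⊑-□ p , q

⊑ᵇ-sound : ∀ {Y A} → (Y ⊑ᵇ A) ≡ true → Y ⊑ A
⊑ᵇ-sound {Y} {A} e = let Z , p , q = isSubCode-sound A (code Y) e in subst (_⊑ A) (code-injective q) p

-- A table value at code k packs (provable?, refutable?, □-refutable?) for the formula coded by k.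
thmEntry boxRefutedEntry : ℕ → Bool
thmEntry        t = isNonZero (unpair₁ t)
boxRefutedEntry t = isNonZero (unpair₂ (unpair₂ t))

thmEntry-pr : PrimRecPred 1 (_$ⁿ_ {n = 1} thmEntry)
thmEntry-pr = ext-pr (λ { (t ∷ []) → refl }) (isNonZero-pr (app₁ unpair₁-pr (proj-pr (# 0))))

boxRefutedEntry-pr : PrimRecPred 1 (_$ⁿ_ {n = 1} boxRefutedEntry)
boxRefutedEntry-pr = ext-pr (λ { (t ∷ []) → refl }) (isNonZero-pr (app₁ unpair₂-pr (app₁ unpair₂-pr (proj-pr (# 0)))))

-- Opaque: relating these to codes of formulas by unfolding the pairing function is very costly.
opaque
  boxCode negCode : ℕ → ℕ
  boxCode x = pair 3 x
  negCode x = pair 2 (pair x (code ⊥'))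

  boxCode-code : ∀ X → boxCode (code X) ≡ code (□ X)
  boxCode-code X = refl

  negCode-code : ∀ X → negCode (code X) ≡ code (¬' X)
  negCode-code X = refl

  boxCode-pr : PrimRec₁ boxCode
  boxCode-pr = ext-pr (λ { (x ∷ []) → refl }) (app₂ pair-pr (const-pr 3) (proj-pr (# 0)))

  negCode-pr : PrimRec₁ negCode
  negCode-pr = ext-pr (λ { (x ∷ []) → refl }) (app₂ pair-pr (const-pr 2) (app₂ pair-pr (proj-pr (# 0)) (const-pr (code ⊥'))))

holdsAs : Bool → Bool → Bool
holdsAs b v = if b then v else not v

holdsAs-elim : ∀ b {v} → holdsAs b v ≡ true → v ≡ b
holdsAs-elim true  e = e
holdsAs-elim false e = not-true e

holdsAs-intro : ∀ b {v} → v ≡ b → holdsAs b v ≡ true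
holdsAs-intro true  refl = refl
holdsAs-intro false refl = refl

holdsAs-false : ∀ b {v} → holdsAs b v ≡ false → v ≡ not b
holdsAs-false true  e = e
holdsAs-false false e = trans (sym (not-involutive _)) (cong not e)

module Decision (L : Logic) where

  opaque
    constraintBody : (thmX boxRefutedX boxedX occursNeg occursNegBox vX vNeg vNegBox isBot : Bool) → Bool
    constraintBody thmX rbX boxedX occN occNB vX vN vNB bot =
        (thmX ⇒ᵇ vX)
      ∧ (hasP L ⇒ᵇ bot ⇒ᵇ not vX)
      ∧ (has4 L ⇒ᵇ boxedX ⇒ᵇ vX)
      ∧ (hasD L ⇒ᵇ (rbX ⇒ᵇ not vX) ∧ (occN ⇒ᵇ not (vX ∧ vN)))
      ∧ (hasD L ∧ has4 L ⇒ᵇ occNB ⇒ᵇ not (vX ∧ vNB))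

    constraintBody-pr : ∀ {n a₁ a₂ a₃ a₄ a₅ a₆ a₇ a₈ a₉}
      → PrimRecPred n a₁ → PrimRecPred n a₂ → PrimRecPred n a₃ → PrimRecPred n a₄ → PrimRecPred n a₅
      → PrimRecPred n a₆ → PrimRecPred n a₇ → PrimRecPred n a₈ → PrimRecPred n a₉
      → PrimRecPred n (λ xs → constraintBody (a₁ xs) (a₂ xs) (a₃ xs) (a₄ xs) (a₅ xs) (a₆ xs) (a₇ xs) (a₈ xs) (a₉ xs))
    constraintBody-pr p₁ p₂ p₃ p₄ p₅ p₆ p₇ p₈ p₉ =
      ∧-pr (⇒ᵇ-pr p₁ p₆)
      (∧-pr (⇒ᵇ-pr (constᵇ-pr (hasP L)) (⇒ᵇ-pr p₉ (not-pr p₆)))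
      (∧-pr (⇒ᵇ-pr (constᵇ-pr (has4 L)) (⇒ᵇ-pr p₃ p₆))
      (∧-pr (⇒ᵇ-pr (constᵇ-pr (hasD L)) (∧-pr (⇒ᵇ-pr p₂ (not-pr p₆)) (⇒ᵇ-pr p₄ (not-pr (∧-pr p₆ p₇)))))
            (⇒ᵇ-pr (∧-pr (constᵇ-pr (hasD L)) (constᵇ-pr (has4 L))) (⇒ᵇ-pr p₅ (not-pr (∧-pr p₆ p₈)))))))

  -- Constraints on the atom □X (x = code X) under the valuation s, inside the formula coded by n
  -- whose table history is h.
  constraintCode : ℕ → ℕ → ℕ → ℕ → Bool
  constraintCode x s n h = constraintBody
    (thmEntry (cvLookup n h x)) (boxRefutedEntry (cvLookup n h x))
    (caseCode x (λ _ → false) false (λ _ _ → false) (λ y → valuationOf s (boxCode y)))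
    (isSubCode n (boxCode (negCode x))) (isSubCode n (boxCode (negCode (boxCode x))))
    (valuationOf s (boxCode x)) (valuationOf s (boxCode (negCode x))) (valuationOf s (boxCode (negCode (boxCode x))))
    (x ≡ᵇ code ⊥')

  constraintCode-pr : PrimRecPred 4 (_$ⁿ_ {n = 4} constraintCode)
  constraintCode-pr = ext-pr (λ { (x ∷ s ∷ n ∷ h ∷ []) → refl }) constraint-pr
    where
    px = proj-pr {4} (# 0)
    ps = proj-pr {4} (# 1)
    pn = proj-pr {4} (# 2)
    ph = proj-pr {4} (# 3)
    lookupX = app₃ cvLookup-pr pn ph px
    constraint-pr : PrimRecPred 4 (λ xs → constraintCode (lookup xs (# 0)) (lookup xs (# 1)) (lookup xs (# 2)) (lookup xs (# 3)))
    constraint-pr = constraintBody-pr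
      (compose-pr thmEntry-pr (lookupX ∷ []))
      (compose-pr boxRefutedEntry-pr (lookupX ∷ []))
      (caseCodeᵇ-pr px (constᵇ-pr false) (constᵇ-pr false) (constᵇ-pr false)
                    (appᵇ₂ valuationOf-pr (proj-pr (# 2)) (app₁ boxCode-pr (proj-pr (# 0)))))
      (appᵇ₂ isSubCode-pr pn (app₁ boxCode-pr (app₁ negCode-pr px)))
      (appᵇ₂ isSubCode-pr pn (app₁ boxCode-pr (app₁ negCode-pr (app₁ boxCode-pr px))))
      (appᵇ₂ valuationOf-pr ps (app₁ boxCode-pr px))
      (appᵇ₂ valuationOf-pr ps (app₁ boxCode-pr (app₁ negCode-pr px)))
      (appᵇ₂ valuationOf-pr ps (app₁ boxCode-pr (app₁ negCode-pr (app₁ boxCode-pr px))))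
      (≡ᵇ-pr px (const-pr (code ⊥')))

  admissibleCode : ℕ → ℕ → ℕ → Bool
  admissibleCode n h s =
    all≤ n (λ m → isSubCode n m ⇒ᵇ caseCode m (λ _ → true) true (λ _ _ → true) (λ x → constraintCode x s n h))

  admissibleCode-pr : PrimRecPred 3 (_$ⁿ_ {n = 3} admissibleCode)
  admissibleCode-pr = ext-pr (λ { (n ∷ h ∷ s ∷ []) → refl })
    (compose-pr (all≤-pr atBoxCode-pr) (proj-pr (# 0) ∷ proj-pr (# 0) ∷ proj-pr (# 1) ∷ proj-pr (# 2) ∷ []))
    where
    atBoxCode-pr : PrimRecPred 4 (λ xs → isSubCode (lookup xs (# 1)) (lookup xs (# 0)) ⇒ᵇ
      caseCode (lookup xs (# 0)) (λ _ → true) true (λ _ _ → true)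
               (λ x → constraintCode x (lookup xs (# 3)) (lookup xs (# 1)) (lookup xs (# 2))))
    atBoxCode-pr = ⇒ᵇ-pr (appᵇ₂ isSubCode-pr (proj-pr (# 1)) (proj-pr (# 0)))
      (caseCodeᵇ-pr (proj-pr (# 0)) (constᵇ-pr true) (constᵇ-pr true) (constᵇ-pr true)
        (compose-pr constraintCode-pr (proj-pr (# 0) ∷ proj-pr (# 4) ∷ proj-pr (# 2) ∷ proj-pr (# 3) ∷ [])))

  -- Valuations of the atoms of the formula coded by n are all encoded below encodingBound (suc n).
  alwaysCode : Bool → ℕ → ℕ → Bool
  alwaysCode b n h = all≤ (encodingBound (suc n)) (λ s → admissibleCode n h s ⇒ᵇ holdsAs b (evalCode n s))

  alwaysCode-pr : ∀ b → PrimRecPred 2 (_$ⁿ_ {n = 2} (alwaysCode b))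
  alwaysCode-pr b = ext-pr (λ { (n ∷ h ∷ []) → refl })
    (compose-pr (all≤-pr (⇒ᵇ-pr (compose-pr admissibleCode-pr (proj-pr (# 1) ∷ proj-pr (# 2) ∷ proj-pr (# 0) ∷ []))
                                (holds-pr b)))
                (app₁ encodingBound-pr (app₁ suc-pr (proj-pr (# 0))) ∷ proj-pr (# 0) ∷ proj-pr (# 1) ∷ []))
    where
    holds-pr : ∀ b → PrimRecPred 3 (λ xs → holdsAs b (evalCode (lookup xs (# 1)) (lookup xs (# 0))))
    holds-pr true  = appᵇ₂ evalCode-pr (proj-pr (# 1)) (proj-pr (# 0))
    holds-pr false = not-pr (appᵇ₂ evalCode-pr (proj-pr (# 1)) (proj-pr (# 0)))

  boxRefutedCode : ℕ → ℕ → Bool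
  boxRefutedCode n h = alwaysCode false n h ∨ caseCode n
    (λ _ → false)
    false
    (λ a b → (b ≡ᵇ code ⊥') ∧ thmEntry (cvLookup n h a))
    (λ a → has4 L ∧ boxRefutedEntry (cvLookup n h a))

  boxRefutedCode-pr : PrimRecPred 2 (_$ⁿ_ {n = 2} boxRefutedCode)
  boxRefutedCode-pr = ext-pr (λ { (n ∷ h ∷ []) → refl }) (∨-pr (alwaysCode-pr false) cases-pr)
    where
    cases-pr : PrimRecPred 2 (λ xs → caseCode (lookup xs (# 0)) (λ _ → false) false
      (λ a b → (b ≡ᵇ code ⊥') ∧ thmEntry (cvLookup (lookup xs (# 0)) (lookup xs (# 1)) a))
      (λ a → has4 L ∧ boxRefutedEntry (cvLookup (lookup xs (# 0)) (lookup xs (# 1)) a)))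
    cases-pr = caseCodeᵇ-pr (proj-pr (# 0)) (constᵇ-pr false) (constᵇ-pr false)
      (∧-pr (≡ᵇ-pr (proj-pr (# 1)) (const-pr (code ⊥')))
            (compose-pr thmEntry-pr (app₃ cvLookup-pr (proj-pr (# 2)) (proj-pr (# 3)) (proj-pr (# 0)) ∷ [])))
      (∧-pr (constᵇ-pr (has4 L))
            (compose-pr boxRefutedEntry-pr (app₃ cvLookup-pr (proj-pr (# 1)) (proj-pr (# 2)) (proj-pr (# 0)) ∷ [])))

  tableStep : ℕ → ℕ → ℕ → ℕ
  tableStep n h _ = pair (fromBool (alwaysCode true n h)) (pair (fromBool (alwaysCode false n h)) (fromBool (boxRefutedCode n h)))

  history : ℕ → ℕ
  history n = cvHistory tableStep n 0

  decideCode : ℕ → Bool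
  decideCode n = thmEntry (cvValue tableStep n 0)

  decideCode-pr : PrimRecPred 1 (_$ⁿ_ {n = 1} decideCode)
  decideCode-pr = ext-pr (λ { (n ∷ []) → refl })
    (compose-pr thmEntry-pr (app₂ (cvValue-pr tableStep-pr) (proj-pr (# 0)) zero-pr ∷ []))
    where
    tableStep-pr : PrimRec₃ tableStep
    tableStep-pr = ext-pr (λ { (n ∷ h ∷ _ ∷ []) → refl })
      (app₂ pair-pr (compose-pr (alwaysCode-pr true) (proj-pr (# 0) ∷ proj-pr (# 1) ∷ []))
        (app₂ pair-pr (compose-pr (alwaysCode-pr false) (proj-pr (# 0) ∷ proj-pr (# 1) ∷ []))
                      (compose-pr boxRefutedCode-pr (proj-pr (# 0) ∷ proj-pr (# 1) ∷ []))))

-- Opaque: the program is a huge term that must never be normalised.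
opaque
  decisionProgram : Logic → PR 1
  decisionProgram L = program (Decision.decideCode-pr L)

  decisionProgram-def : ∀ L → decisionProgram L ≡ program (Decision.decideCode-pr L)
  decisionProgram-def L = refl

decisionProgram-eval : ∀ L n → eval (decisionProgram L) (n ∷ []) ≡ fromBool (Decision.decideCode L n)
decisionProgram-eval L n = eval-≡-program (Decision.decideCode-pr L) (decisionProgram L) (decisionProgram-def L) (n ∷ [])

boxVal : (ℕ → Bool) → Fm → Bool
boxVal w X = w (code (□ X))

boxedValue : (Fm → Bool) → Fm → Bool
boxedValue v (□ Y) = v Y
boxedValue v _     = false

module Semantics (L : Logic) where
  open Decision L public

  opaque
    always? : Bool → Fm → Bool
    always? b A = alwaysCode b (code A) (history (code A))

    boxRefuted? : Fm → Bool
    boxRefuted? A = boxRefutedCode (code A) (history (code A))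

    always?-def : ∀ b A → always? b A ≡ alwaysCode b (code A) (history (code A))
    always?-def b A = refl

    boxRefuted?-def : ∀ A → boxRefuted? A ≡ boxRefutedCode (code A) (history (code A))
    boxRefuted?-def A = refl

  thm? refuted? : Fm → Bool
  thm?     = always? true
  refuted? = always? false

  private
    tableAt : ∀ {n} X → code X < n → cvLookup n (history n) (code X)
      ≡ pair (fromBool (thm? X)) (pair (fromBool (refuted? X)) (fromBool (boxRefuted? X)))
    tableAt X lt = trans (cvLookup-history tableStep lt)
      (cong₂ pair (cong fromBool (sym (always?-def true X)))
                  (cong₂ pair (cong fromBool (sym (always?-def false X))) (cong fromBool (sym (boxRefuted?-def X)))))

  thmEntry-history : ∀ {n} X → code X < n → thmEntry (cvLookup n (history n) (code X)) ≡ thm? X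
  thmEntry-history X lt = trans (cong thmEntry (tableAt X lt))
    (trans (cong isNonZero (unpair₁-pair (fromBool (thm? X)) (pair (fromBool (refuted? X)) (fromBool (boxRefuted? X)))))
           (isNonZero-fromBool (thm? X)))

  boxRefutedEntry-history : ∀ {n} X → code X < n → boxRefutedEntry (cvLookup n (history n) (code X)) ≡ boxRefuted? X
  boxRefutedEntry-history X lt = trans (cong boxRefutedEntry (tableAt X lt))
    (trans (cong (isNonZero ∘ unpair₂) (unpair₂-pair (fromBool (thm? X)) (pair (fromBool (refuted? X)) (fromBool (boxRefuted? X)))))
    (trans (cong isNonZero (unpair₂-pair (fromBool (refuted? X)) (fromBool (boxRefuted? X))))
           (isNonZero-fromBool (boxRefuted? X))))

  decideCode-code : ∀ A → decideCode (code A) ≡ thm? A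
  decideCode-code A = trans (cong isNonZero (unpair₁-pair (fromBool (alwaysCode true (code A) (history (code A))))
                                                          (pair (fromBool (alwaysCode false (code A) (history (code A))))
                                                                (fromBool (boxRefutedCode (code A) (history (code A)))))))
                            (trans (isNonZero-fromBool _) (sym (always?-def true A)))

  -- v X is the truth value of the atom □X; Occurs Z says that □Z is an atom under consideration.
  record Constraints (Occurs : Fm → Set) (v : Fm → Bool) (X : Fm) : Set where
    field
      thm⇒true     : thm? X ≡ true → v X ≡ true
      P-⊥-false    : hasP L ≡ true → X ≡ ⊥' → v X ≡ false
      4-lift       : has4 L ≡ true → ∀ {Y} → X ≡ □ Y → v Y ≡ true → v X ≡ true
      D-boxRefuted : hasD L ≡ true → boxRefuted? X ≡ true → v X ≡ false
      D-neg        : hasD L ≡ true → Occurs (¬' X) → v X ≡ true → v (¬' X) ≡ false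
      D4-negBox    : hasD L ≡ true → has4 L ≡ true → Occurs (¬' (□ X)) → v X ≡ true → v (¬' (□ X)) ≡ false
  open Constraints public

  Admissible : Fm → (ℕ → Bool) → Set
  Admissible A w = ∀ {X} → □ X ⊑ A → Constraints (λ Z → □ Z ⊑ A) (boxVal w) X

  constraintᵇ : Fm → (Fm → Bool) → Fm → Bool
  constraintᵇ A v X = constraintBody (thm? X) (boxRefuted? X) (boxedValue v X)
    (□ (¬' X) ⊑ᵇ A) (□ (¬' (□ X)) ⊑ᵇ A) (v X) (v (¬' X)) (v (¬' (□ X))) (code X ≡ᵇ code ⊥')

  private
    constraintBody-cong : ∀ {a₁ a₂ a₃ a₄ a₅ a₆ a₇ a₈ b₁ b₂ b₃ b₄ b₅ b₆ b₇ b₈ c}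
      → a₁ ≡ b₁ → a₂ ≡ b₂ → a₃ ≡ b₃ → a₄ ≡ b₄ → a₅ ≡ b₅ → a₆ ≡ b₆ → a₇ ≡ b₇ → a₈ ≡ b₈
      → constraintBody a₁ a₂ a₃ a₄ a₅ a₆ a₇ a₈ c ≡ constraintBody b₁ b₂ b₃ b₄ b₅ b₆ b₇ b₈ c
    constraintBody-cong refl refl refl refl refl refl refl refl = refl

    negBoxCode-code : ∀ X → boxCode (negCode (code X)) ≡ code (□ (¬' X))
    negBoxCode-code X = trans (cong boxCode (negCode-code X)) (boxCode-code (¬' X))

    negBoxBoxCode-code : ∀ X → boxCode (negCode (boxCode (code X))) ≡ code (□ (¬' (□ X)))
    negBoxBoxCode-code X = trans (cong (boxCode ∘ negCode) (boxCode-code X)) (negBoxCode-code (□ X))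

  constraintCode-code : ∀ {A X} s → □ X ⊑ A
    → constraintCode (code X) s (code A) (history (code A)) ≡ constraintᵇ A (boxVal (valuationOf s)) X
  constraintCode-code {A} {X} s p = constraintBody-cong
    (thmEntry-history X (code-<-□⊑ p))
    (boxRefutedEntry-history X (code-<-□⊑ p))
    (boxed X)
    (cong (isSubCode (code A)) (negBoxCode-code X))
    (cong (isSubCode (code A)) (negBoxBoxCode-code X))
    (cong (valuationOf s) (boxCode-code X))
    (cong (valuationOf s) (negBoxCode-code X))
    (cong (valuationOf s) (negBoxBoxCode-code X))
    where
    boxed : ∀ X → caseCode (code X) (λ _ → false) false (λ _ _ → false) (λ y → valuationOf s (boxCode y))
                ≡ boxedValue (boxVal (valuationOf s)) X
    boxed (var k) = caseCode-var k
    boxed ⊥'      = caseCode-⊥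
    boxed (B ⇒ C) = caseCode-⇒ B C
    boxed (□ Y)   = trans (caseCode-□ Y) (cong (valuationOf s) (boxCode-code Y))

  opaque
    unfolding constraintBody

    constraintBody-elim : ∀ {thmX rbX boxedX occN occNB vX vN vNB bot}
      → constraintBody thmX rbX boxedX occN occNB vX vN vNB bot ≡ true
      → (thmX ⇒ᵇ vX) ≡ true
      × (hasP L ⇒ᵇ bot ⇒ᵇ not vX) ≡ true
      × (has4 L ⇒ᵇ boxedX ⇒ᵇ vX) ≡ true
      × (hasD L ⇒ᵇ (rbX ⇒ᵇ not vX) ∧ (occN ⇒ᵇ not (vX ∧ vN))) ≡ true
      × (hasD L ∧ has4 L ⇒ᵇ occNB ⇒ᵇ not (vX ∧ vNB)) ≡ true
    constraintBody-elim {thmX} {rbX} {boxedX} {occN} {occNB} {vX} {vN} {vNB} {bot} e =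
      ∧-conicalˡ c₁ _ e , ∧-conicalˡ c₂ _ e₁ , ∧-conicalˡ c₃ _ e₂ , ∧-conicalˡ c₄ c₅ e₃ , ∧-conicalʳ c₄ c₅ e₃
      where
      c₁ c₂ c₃ c₄ c₅ : Bool
      c₁ = thmX ⇒ᵇ vX
      c₂ = hasP L ⇒ᵇ bot ⇒ᵇ not vX
      c₃ = has4 L ⇒ᵇ boxedX ⇒ᵇ vX
      c₄ = hasD L ⇒ᵇ (rbX ⇒ᵇ not vX) ∧ (occN ⇒ᵇ not (vX ∧ vN))
      c₅ = hasD L ∧ has4 L ⇒ᵇ occNB ⇒ᵇ not (vX ∧ vNB)
      e₁ : (c₂ ∧ c₃ ∧ c₄ ∧ c₅) ≡ true
      e₁ = ∧-conicalʳ c₁ _ e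
      e₂ : (c₃ ∧ c₄ ∧ c₅) ≡ true
      e₂ = ∧-conicalʳ c₂ _ e₁
      e₃ : (c₄ ∧ c₅) ≡ true
      e₃ = ∧-conicalʳ c₃ _ e₂

    constraintBody-intro : ∀ {thmX rbX boxedX occN occNB vX vN vNB bot}
      → (thmX ⇒ᵇ vX) ≡ true
      → (hasP L ⇒ᵇ bot ⇒ᵇ not vX) ≡ true
      → (has4 L ⇒ᵇ boxedX ⇒ᵇ vX) ≡ true
      → (hasD L ⇒ᵇ (rbX ⇒ᵇ not vX) ∧ (occN ⇒ᵇ not (vX ∧ vN))) ≡ true
      → (hasD L ∧ has4 L ⇒ᵇ occNB ⇒ᵇ not (vX ∧ vNB)) ≡ true
      → constraintBody thmX rbX boxedX occN occNB vX vN vNB bot ≡ true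
    constraintBody-intro c₁ c₂ c₃ c₄ c₅ = ∧ᵇ-intro c₁ (∧ᵇ-intro c₂ (∧ᵇ-intro c₃ (∧ᵇ-intro c₄ c₅)))

  constraintᵇ-sound : ∀ {A v X} → constraintᵇ A v X ≡ true → Constraints (λ Z → □ Z ⊑ A) v X
  constraintᵇ-sound {A} {v} {X} e = let c₁ , c₂ , c₃ , c₄ , c₅ = constraintBody-elim e in record
    { thm⇒true     = ⇒ᵇ-elim c₁
    ; P-⊥-false    = λ { P refl → not-true (⇒ᵇ-elim (⇒ᵇ-elim c₂ P) refl) }
    ; 4-lift       = λ { 4ax refl vY → ⇒ᵇ-elim (⇒ᵇ-elim c₃ 4ax) vY }
    ; D-boxRefuted = λ D rb → not-true (⇒ᵇ-elim (∧-conicalˡ (boxRefuted? X ⇒ᵇ not (v X)) _ (⇒ᵇ-elim c₄ D)) rb)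
    ; D-neg        = λ D occ vX →
        nand-elim (⇒ᵇ-elim (∧-conicalʳ (boxRefuted? X ⇒ᵇ not (v X)) _ (⇒ᵇ-elim c₄ D)) (⊑ᵇ-complete occ)) vX
    ; D4-negBox    = λ D 4ax occ vX → nand-elim (⇒ᵇ-elim (⇒ᵇ-elim c₅ (∧ᵇ-intro D 4ax)) (⊑ᵇ-complete occ)) vX
    }

  constraintᵇ-complete : ∀ {A v X} → Constraints (λ Z → □ Z ⊑ A) v X → constraintᵇ A v X ≡ true
  constraintᵇ-complete {A} {v} {X} c = constraintBody-intro
    (⇒ᵇ-intro (thm⇒true c))
    (⇒ᵇ-intro (λ P → ⇒ᵇ-intro (λ bot → cong not (P-⊥-false c P (code-injective (≡ᵇ-true bot))))))
    (⇒ᵇ-intro (λ 4ax → ⇒ᵇ-intro (boxed-lift 4ax X refl)))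
    (⇒ᵇ-intro (λ D → ∧ᵇ-intro (⇒ᵇ-intro (cong not ∘ D-boxRefuted c D))
                               (⇒ᵇ-intro (λ occ → nand-intro (D-neg c D (⊑ᵇ-sound occ))))))
    (⇒ᵇ-intro (λ D4 → ⇒ᵇ-intro (λ occ →
      nand-intro (D4-negBox c (∧-conicalˡ (hasD L) (has4 L) D4) (∧-conicalʳ (hasD L) (has4 L) D4) (⊑ᵇ-sound occ)))))
    where
    boxed-lift : has4 L ≡ true → ∀ Z → Z ≡ X → boxedValue v Z ≡ true → v X ≡ true
    boxed-lift 4ax (□ Y) refl vY = 4-lift c 4ax refl vY

  Constraints-cong : ∀ {A v v′ X} → (∀ {Z} → □ Z ⊑ A → v Z ≡ v′ Z) → □ X ⊑ A
    → Constraints (λ Z → □ Z ⊑ A) v X → Constraints (λ Z → □ Z ⊑ A) v′ X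
  Constraints-cong {X = X} v≗v′ p c = record
    { thm⇒true     = λ t → trans (sym (v≗v′ p)) (thm⇒true c t)
    ; P-⊥-false    = λ P eq → trans (sym (v≗v′ p)) (P-⊥-false c P eq)
    ; 4-lift       = λ { 4ax refl vY → trans (sym (v≗v′ p)) (4-lift c 4ax refl (trans (v≗v′ (□⊑⇒⊑ p)) vY)) }
    ; D-boxRefuted = λ D rb → trans (sym (v≗v′ p)) (D-boxRefuted c D rb)
    ; D-neg        = λ D occ vX → trans (sym (v≗v′ occ)) (D-neg c D occ (trans (v≗v′ p) vX))
    ; D4-negBox    = λ D 4ax occ vX → trans (sym (v≗v′ occ)) (D4-negBox c D 4ax occ (trans (v≗v′ p) vX))
    }

  Constraints-mono : ∀ {Occ Occ′ v X} → (∀ {Z} → Occ′ Z → Occ Z) → Constraints Occ v X → Constraints Occ′ v X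
  Constraints-mono occ c = record
    { thm⇒true     = thm⇒true c
    ; P-⊥-false    = P-⊥-false c
    ; 4-lift       = 4-lift c
    ; D-boxRefuted = D-boxRefuted c
    ; D-neg        = λ D → D-neg c D ∘ occ
    ; D4-negBox    = λ D 4ax → D4-negBox c D 4ax ∘ occ
    }

  Admissible-local : ∀ {A w w′} → (∀ m → m ≤ code A → w m ≡ w′ m) → Admissible A w → Admissible A w′
  Admissible-local agree adm p = Constraints-cong (λ q → agree _ (code-mono-⊑ q)) p (adm p)

  admissibleCode-sound : ∀ {A} s → admissibleCode (code A) (history (code A)) s ≡ true → Admissible A (valuationOf s)
  admissibleCode-sound {A} s e {X} p = constraintᵇ-sound (trans (sym (constraintCode-code s p))
    (trans (sym (caseCode-□ X)) (⇒ᵇ-elim (all≤-elim _ _ e (code (□ X)) (code-mono-⊑ p)) (⊑ᵇ-complete p))))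

  admissibleCode-complete : ∀ {A} s → Admissible A (valuationOf s) → admissibleCode (code A) (history (code A)) s ≡ true
  admissibleCode-complete {A} s adm = all≤-intro _ _ λ m _ → ⇒ᵇ-intro λ sub →
    let Y , p , codeY≡m = isSubCode-sound A m sub in subst (λ m → caseAt m ≡ true) codeY≡m (at Y p)
    where
    caseAt : ℕ → Bool
    caseAt m = caseCode m (λ _ → true) true (λ _ _ → true) (λ x → constraintCode x s (code A) (history (code A)))
    at : ∀ Y → Y ⊑ A → caseAt (code Y) ≡ true
    at (var k) _ = caseCode-var k
    at ⊥'      _ = caseCode-⊥
    at (B ⇒ C) _ = caseCode-⇒ B C
    at (□ X)   p = trans (caseCode-□ X) (trans (constraintCode-code s p) (constraintᵇ-complete (adm p)))

  private
    encode-agrees : ∀ w n m → m ≤ n → w m ≡ valuationOf (encode w (suc n)) m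
    encode-agrees w n m m≤n = sym (valuationOf-encode w (suc n) m (s≤s m≤n))

  always?-elim : ∀ {b A} → always? b A ≡ true → ∀ w → Admissible A w → sem w A ≡ b
  always?-elim {b} {A} e w adm = begin
    sem w A                     ≡⟨ sem-local A (encode-agrees w (code A)) ⟩
    sem (valuationOf s) A       ≡⟨ sym (evalCode-code A s) ⟩
    evalCode (code A) s         ≡⟨ holdsAs-elim b (⇒ᵇ-elim holds admissible) ⟩
    b                           ∎
    where
    open ≡-Reasoning
    s = encode w (suc (code A))
    holds : (admissibleCode (code A) (history (code A)) s ⇒ᵇ holdsAs b (evalCode (code A) s)) ≡ true
    holds = all≤-elim _ _ (trans (sym (always?-def b A)) e) s (encode-≤ w (suc (code A)))
    admissible : admissibleCode (code A) (history (code A)) s ≡ true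
    admissible = admissibleCode-complete s (Admissible-local (encode-agrees w (code A)) adm)

  always?-intro : ∀ {b A} → (∀ w → Admissible A w → sem w A ≡ b) → always? b A ≡ true
  always?-intro {b} {A} H = trans (always?-def b A) (all≤-intro _ _ λ s _ → ⇒ᵇ-intro λ adm →
    holdsAs-intro b (trans (evalCode-code A s) (H (valuationOf s) (admissibleCode-sound s adm))))

  always?-false : ∀ {b A} → always? b A ≡ false → Σ[ w ∈ (ℕ → Bool) ] Admissible A w × sem w A ≡ not b
  always?-false {b} {A} e =
    let s , _ , fails = all≤-false _ _ (trans (sym (always?-def b A)) e)
        adm , ¬holds = ⇒ᵇ-false fails
    in valuationOf s , admissibleCode-sound s adm , trans (sym (evalCode-code A s)) (holdsAs-false b ¬holds)

  -- The reasons for ⊢ ¬□X other than ⊢ ¬X: X = ¬E with ⊢ E (by D), or X = □Y with ⊢ ¬□Y (by 4 and D).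
  boxRefutedBy : Fm → Bool
  boxRefutedBy (E ⇒ F) = (code F ≡ᵇ code ⊥') ∧ thm? E
  boxRefutedBy (□ Y)   = has4 L ∧ boxRefuted? Y
  boxRefutedBy _       = false

  boxRefuted?-unfold : ∀ X → boxRefuted? X ≡ refuted? X ∨ boxRefutedBy X
  boxRefuted?-unfold X = trans (boxRefuted?-def X) (cong₂ _∨_ (sym (always?-def false X)) (by-shape X))
    where
    by-shape : ∀ X → caseCode (code X) (λ _ → false) false
      (λ a b → (b ≡ᵇ code ⊥') ∧ thmEntry (cvLookup (code X) (history (code X)) a))
      (λ a → has4 L ∧ boxRefutedEntry (cvLookup (code X) (history (code X)) a))
      ≡ boxRefutedBy X
    by-shape (var k) = caseCode-var k
    by-shape ⊥'      = caseCode-⊥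
    by-shape (E ⇒ F) = trans (caseCode-⇒ E F) (cong ((code F ≡ᵇ code ⊥') ∧_) (thmEntry-history E (code-<-⇒ˡ E F)))
    by-shape (□ Y)   = trans (caseCode-□ Y) (cong (has4 L ∧_) (boxRefutedEntry-history Y (code-<-□ Y)))

boxes : Fm → List Fm
boxes (var k) = []
boxes ⊥'      = []
boxes (A ⇒ B) = boxes A ++ boxes B
boxes (□ A)   = A ∷ boxes A

∈-boxes⇒□⊑ : ∀ {X A} → X ∈ boxes A → □ X ⊑ A
∈-boxes⇒□⊑ {A = A ⇒ B} p with ∈-++⁻ (boxes A) p
... | inj₁ q = ⊑-⇒ˡ (∈-boxes⇒□⊑ q)
... | inj₂ q = ⊑-⇒ʳ (∈-boxes⇒□⊑ q)
∈-boxes⇒□⊑ {A = □ A} (here refl) = ⊑-refl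
∈-boxes⇒□⊑ {A = □ A} (there p)   = ⊑-□ (∈-boxes⇒□⊑ p)

□⊑⇒∈-boxes : ∀ {X A} → □ X ⊑ A → X ∈ boxes A
□⊑⇒∈-boxes ⊑-refl                = here refl
□⊑⇒∈-boxes {A = A ⇒ B} (⊑-⇒ˡ p) = ∈-++⁺ˡ (□⊑⇒∈-boxes p)
□⊑⇒∈-boxes {A = A ⇒ B} (⊑-⇒ʳ p) = ∈-++⁺ʳ (boxes A) (□⊑⇒∈-boxes p)
□⊑⇒∈-boxes {A = □ A}   (⊑-□ p)  = there (□⊑⇒∈-boxes p)

infix 4 _≺_
_≺_ : Fm → Fm → Set
_≺_ = _<_ on code

≺-wellFounded : WellFounded _≺_
≺-wellFounded = On.wellFounded code <-wellFounded

4-instance : Fm → Fm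
4-instance (□ Y) = (□ Y) ⇒ (□ (□ Y))
4-instance _     = ⊤'

module Completeness (L : Logic) where
  open Semantics L

  -- Provable formulas whose truth forces the constraints on the atom □X.
  boxHypotheses : Fm → List Fm
  boxHypotheses X =
      when (thm? X) (□ X)
    ∷ when (hasP L) (¬' (□ ⊥'))
    ∷ when (has4 L) (4-instance X)
    ∷ when (hasD L ∧ boxRefuted? X) (¬' (□ X))
    ∷ when (hasD L) (¬' ((□ X) ∧' (□ (¬' X))))
    ∷ when (hasD L ∧ has4 L) (¬' ((□ X) ∧' (□ (¬' (□ X)))))
    ∷ []

  boxHypotheses-constraints : ∀ {Occurs w X} → All (λ G → sem w G ≡ true) (boxHypotheses X)
    → Constraints Occurs (boxVal w) X
  boxHypotheses-constraints {w = w} {X} (h₁ ∷ h₂ ∷ h₃ ∷ h₄ ∷ h₅ ∷ h₆ ∷ []) = record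
    { thm⇒true     = sem-when w _ _ h₁
    ; P-⊥-false    = λ { P refl → sem-¬ w (□ ⊥') (sem-when w _ _ h₂ P) }
    ; 4-lift       = λ { 4ax refl → ⇒ᵇ-elim (sem-when w _ _ h₃ 4ax) }
    ; D-boxRefuted = λ D rb → sem-¬ w (□ X) (sem-when w _ _ h₄ (∧ᵇ-intro D rb))
    ; D-neg        = λ D _ → sem-¬∧-elim w (□ X) (□ (¬' X)) (sem-when w _ _ h₅ D)
    ; D4-negBox    = λ D 4ax _ → sem-¬∧-elim w (□ X) (□ (¬' (□ X))) (sem-when w _ _ h₆ (∧ᵇ-intro D 4ax))
    }

  boxHypotheses-provable : ∀ X → (thm? X ≡ true → L ⊢ X) → (hasD L ≡ true → boxRefuted? X ≡ true → L ⊢ (¬' (□ X)))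
    → All (L ⊢_) (boxHypotheses X)
  boxHypotheses-provable X ⊢X ⊢¬□X =
      when-intro _ _ (nec ∘ ⊢X)
    ∷ when-intro _ _ (P-axiom L)
    ∷ when-intro _ _ (4-instance-provable X)
    ∷ when-intro _ _ (λ e → ⊢¬□X (∧-conicalˡ _ _ e) (∧-conicalʳ _ _ e))
    ∷ when-intro _ _ (D-axiom L X)
    ∷ when-intro _ _ (λ e → D4-theorem L X (∧-conicalˡ _ _ e) (∧-conicalʳ _ _ e))
    ∷ []
    where
    4-instance-provable : ∀ X → has4 L ≡ true → L ⊢ 4-instance X
    4-instance-provable (var k) _   = ⊤-intro
    4-instance-provable ⊥'      _   = ⊤-intro
    4-instance-provable (A ⇒ B) _   = ⊤-intro
    4-instance-provable (□ Y)   4ax = 4-axiom L Y 4ax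

  Complete : Fm → Set
  Complete A = (thm? A ≡ true → L ⊢ A)
             × (refuted? A ≡ true → L ⊢ (¬' A))
             × (hasD L ≡ true → boxRefuted? A ≡ true → L ⊢ (¬' (□ A)))

  boxRefutedBy-complete : ∀ A → (∀ {X} → X ≺ A → Complete X) → hasD L ≡ true → boxRefutedBy A ≡ true
    → L ⊢ (¬' (□ A))
  boxRefutedBy-complete (E ⇒ F) ih D e with code-injective {F} {⊥'} (≡ᵇ-true (∧-conicalˡ _ _ e))
  ... | refl = □⇒¬□¬ D (nec (proj₁ (ih (code-<-⇒ˡ E ⊥')) (∧-conicalʳ _ _ e)))
  boxRefutedBy-complete (□ Y)   ih D e = □¬⇒¬□ D (nec (proj₂ (proj₂ (ih (code-<-□ Y))) D (∧-conicalʳ _ _ e)))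

  complete-step : ∀ A → (∀ {X} → X ≺ A → Complete X) → Complete A
  complete-step A ih = ⊢A , ⊢¬A , ⊢¬□A
    where
    H : Fm
    H = ⋀ (map (⋀ ∘ boxHypotheses) (boxes A))

    ⊢H : L ⊢ H
    ⊢H = ⋀-intro (Allₚ.map⁺ (All.tabulate λ {X} X∈ →
      let small = code-<-□⊑ {A = A} (∈-boxes⇒□⊑ X∈) in
      ⋀-intro (boxHypotheses-provable X (proj₁ (ih small)) (proj₂ (proj₂ (ih small))))))

    H-admissible : ∀ w → sem w H ≡ true → Admissible A w
    H-admissible w e p = boxHypotheses-constraints
      (sem-⋀ w _ (All.lookup (sem-⋀ w _ e) (∈-map⁺ (⋀ ∘ boxHypotheses) (□⊑⇒∈-boxes p))))

    ⊢A : thm? A ≡ true → L ⊢ A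
    ⊢A t = semantic-mp (λ w e → always?-elim t w (H-admissible w e)) ⊢H

    ⊢¬A : refuted? A ≡ true → L ⊢ (¬' A)
    ⊢¬A r = semantic-mp (λ w e → sem-¬-intro w A (always?-elim r w (H-admissible w e))) ⊢H

    ⊢¬□A : hasD L ≡ true → boxRefuted? A ≡ true → L ⊢ (¬' (□ A))
    ⊢¬□A D rb = [ □¬⇒¬□ D ∘ nec ∘ ⊢¬A , boxRefutedBy-complete A ih D ]′
                  (∨-true (refuted? A) (trans (sym (boxRefuted?-unfold A)) rb))

  complete : ∀ A → Complete A
  complete = WF.All.wfRec ≺-wellFounded _ Complete complete-step

module Consistency (L : Logic) where
  open Semantics L
  open Completeness L

  Admissible-¬ : ∀ {A w} → Admissible A w → Admissible (¬' A) w
  Admissible-¬ adm p = Constraints-mono □⊑¬⇒□⊑ (adm (□⊑¬⇒□⊑ p))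

  inconsistent : ∀ {A} → L ⊢ A → L ⊢ (¬' A) → ⊥
  inconsistent a ¬a = consistent (mp ¬a a)

  thm?-⊥ : thm? ⊥' ≡ false
  thm?-⊥ with thm? ⊥' in t
  ... | true  = ⊥-elim (consistent (proj₁ (complete ⊥') t))
  ... | false = refl

  ¬[thm∧boxRefuted] : ∀ {X} → hasD L ≡ true → thm? X ≡ true → boxRefuted? X ≡ true → ⊥
  ¬[thm∧boxRefuted] {X} D t rb = inconsistent (nec (proj₁ (complete X) t)) (proj₂ (proj₂ (complete X)) D rb)

  thm¬⇒refuted : ∀ X → thm? (¬' X) ≡ true → refuted? X ≡ true
  thm¬⇒refuted X t = always?-intro λ w adm → sem-¬ w X (always?-elim t w (Admissible-¬ {w = w} adm))

  refuted⇒boxRefuted : ∀ X → refuted? X ≡ true → boxRefuted? X ≡ true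
  refuted⇒boxRefuted X r = trans (boxRefuted?-unfold X) (cong (_∨ boxRefutedBy X) r)

  thm⇒boxRefuted¬ : ∀ X → thm? X ≡ true → boxRefuted? (¬' X) ≡ true
  thm⇒boxRefuted¬ X t = trans (boxRefuted?-unfold (¬' X)) (∨-introʳ (refuted? (¬' X)) t)

  admissible-exists : ∀ A → Σ[ w ∈ (ℕ → Bool) ] Admissible A w
  admissible-exists A with thm? A in t | refuted? A in r
  ... | false | _     = let w , adm , _ = always?-false t in w , adm
  ... | true  | false = let w , adm , _ = always?-false r in w , adm
  ... | true  | true  = ⊥-elim (inconsistent (proj₁ (complete A) t) (proj₁ (proj₂ (complete A)) r))

  private
    negBoxBody : Fm → Fm
    negBoxBody ((□ Z) ⇒ ⊥') = Z
    negBoxBody _             = ⊥'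

  negBox? : ∀ Y → (Σ[ Z ∈ Fm ] Y ≡ ¬' (□ Z)) ⊎ (∀ {Z} → Y ≢ ¬' (□ Z))
  negBox? Y with Y ≟ᶠ ¬' (□ (negBoxBody Y))
  ... | yes eq  = inj₁ (negBoxBody Y , eq)
  ... | no  neq = inj₂ λ { refl → neq refl }

  -- If Y = ¬□Z is not □-refutable then □Z is not provable, so □Z can be made false.
  admissible-avoiding : ∀ Y → boxRefuted? Y ≡ false
    → Σ[ w ∈ (ℕ → Bool) ] Admissible Y w × (∀ {Z} → Y ≡ ¬' (□ Z) → boxVal w Z ≡ false)
  admissible-avoiding Y rb with negBox? Y
  ... | inj₂ other = let w , adm = admissible-exists Y in w , adm , ⊥-elim ∘ other
  ... | inj₁ (Z , refl) =
    let w , adm , □Z-false = always?-false {true} {□ Z} (∨-conicalʳ _ _ (trans (sym (boxRefuted?-unfold (¬' (□ Z)))) rb))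
    in w , Admissible-¬ {w = w} adm , λ { refl → □Z-false }

  -- Making □Y true keeps a valuation admissible for □Y, provided ¬□Y is not □-refutable and,
  -- when Y = ¬□Z, the atom □Z is false.
  module Raise (D : hasD L ≡ true) {Y w} (rb : boxRefuted? Y ≡ false) (adm : Admissible Y w)
               (avoid : ∀ {Z} → Y ≡ ¬' (□ Z) → boxVal w Z ≡ false) where

    w′ : ℕ → Bool
    w′ = update w (code (□ Y)) true

    w′-Y : boxVal w′ Y ≡ true
    w′-Y = update-same w (code (□ Y)) true

    w′-other : ∀ Z → Z ≢ Y → boxVal w′ Z ≡ boxVal w Z
    w′-other Z Z≢Y = update-other w (code (□ Y)) true (code (□ Z)) (Z≢Y ∘ □-injective ∘ code-injective)
      where
      □-injective : ∀ {P Q} → □ P ≡ □ Q → P ≡ Q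
      □-injective refl = refl

    raised-Y : Constraints (λ Z → □ Z ⊑ □ Y) (boxVal w′) Y
    raised-Y = record
      { thm⇒true     = λ _ → w′-Y
      ; P-⊥-false    = λ P _ → ⊥-elim (true≢false (trans (sym P) (hasD⇒¬hasP L D)))
      ; 4-lift       = λ _ _ _ → w′-Y
      ; D-boxRefuted = λ _ rb′ → ⊥-elim (true≢false (trans (sym rb′) rb))
      ; D-neg        = λ { _ occ _ → ⊥-elim (⋢-smaller (code-<-⇒ˡ Y ⊥') (⊑-below (□⊑⇒⊑ occ))) }
      ; D4-negBox    = λ { _ _ occ _ →
          ⊥-elim (⋢-smaller (<-trans (code-<-□ Y) (code-<-⇒ˡ (□ Y) ⊥')) (⊑-below (□⊑⇒⊑ occ))) }
      }
      where
      ⊑-below : ∀ {X} → (X ⇒ ⊥') ⊑ □ Y → (X ⇒ ⊥') ⊑ Y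
      ⊑-below (⊑-□ p) = p

    w′-below : ∀ {Z} → □ Z ⊑ Y → boxVal w′ Z ≡ boxVal w Z
    w′-below {Z} q = w′-other Z (code-<⇒≢ (code-<-□⊑ q))

    raised-below : ∀ {X} → □ X ⊑ Y → Constraints (λ Z → □ Z ⊑ □ Y) (boxVal w′) X
    raised-below {X} p = record
      { thm⇒true     = λ t → trans (w′-below p) (thm⇒true c t)
      ; P-⊥-false    = λ P eq → trans (w′-below p) (P-⊥-false c P eq)
      ; 4-lift       = λ { 4ax refl vZ → trans (w′-below p) (4-lift c 4ax refl (trans (sym (w′-below (□⊑⇒⊑ p))) vZ)) }
      ; D-boxRefuted = λ D rb′ → trans (w′-below p) (D-boxRefuted c D rb′)
      ; D-neg        = λ D occ vX → [ (λ { refl → ⊥-elim (⋢-smaller (code-<-□ X) (□⊑¬⇒□⊑ p)) })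
                                     , (λ q → trans (w′-below q) (D-neg c D q (trans (sym (w′-below p)) vX))) ]′
                                     (□⊑□-split occ)
      ; D4-negBox    = λ D 4ax occ vX → [ (λ Y≡¬□X → ⊥-elim (true≢false
                                                      (trans (sym vX) (trans (w′-below p) (avoid (sym Y≡¬□X))))))
                                        , (λ q → trans (w′-below q) (D4-negBox c D 4ax q (trans (sym (w′-below p)) vX))) ]′
                                        (□⊑□-split occ)
      }
      where
      c = adm p

    raised-admissible : Admissible (□ Y) w′
    raised-admissible p = [ (λ { refl → raised-Y }) , raised-below ]′ (□⊑□-split p)

  refuted□⇒boxRefuted : has4 L ≡ true → hasD L ≡ true → ∀ Y → refuted? (□ Y) ≡ true → boxRefuted? Y ≡ true
  refuted□⇒boxRefuted 4ax D Y r with boxRefuted? Y in rb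
  ... | true  = refl
  ... | false = ⊥-elim (raising-contradicts (admissible-avoiding Y rb))
    where
    raising-contradicts : (Σ[ w ∈ (ℕ → Bool) ] Admissible Y w × (∀ {Z} → Y ≡ ¬' (□ Z) → boxVal w Z ≡ false)) → ⊥
    raising-contradicts (w , adm , avoid) = true≢false (trans (sym w′-Y) (always?-elim r w′ raised-admissible))
      where open Raise D {Y} {w} rb adm avoid

  boxRefuted□⇒boxRefuted : has4 L ≡ true → hasD L ≡ true → ∀ Y → boxRefuted? (□ Y) ≡ true → boxRefuted? Y ≡ true
  boxRefuted□⇒boxRefuted 4ax D Y rb =
    [ refuted□⇒boxRefuted 4ax D Y , ∧-conicalʳ (has4 L) _ ]′
      (∨-true (refuted? (□ Y)) (trans (sym (boxRefuted?-unfold (□ Y))) rb))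

module Extension (L : Logic) {B : Fm} {w : ℕ → Bool} where
  open Semantics L
  open Consistency L

  inB : Fm → Bool
  inB X = □ X ⊑ᵇ B

  mutual
    ext : Fm → Bool
    ext X = if inB X then boxVal w X else (thm? X ∨ (has4 L ∧ lifted X))

    lifted : Fm → Bool
    lifted (□ Y) = ext Y
    lifted _     = false

  ext-cases : ∀ {P : Bool → Set} X → (□ X ⊑ B → P (boxVal w X)) → (inB X ≡ false → P (thm? X ∨ (has4 L ∧ lifted X)))
            → P (ext X)
  ext-cases X inside outside with inB X in e
  ... | true  = inside (⊑ᵇ-sound e)
  ... | false = outside refl

  private
    outside-false : ∀ {X} → thm? X ≡ false → (has4 L ∧ lifted X) ≡ false → (thm? X ∨ (has4 L ∧ lifted X)) ≡ false
    outside-false t l rewrite t = l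

    outside-¬ : ∀ X → thm? (¬' X) ≡ false → (thm? (¬' X) ∨ (has4 L ∧ lifted (¬' X))) ≡ false
    outside-¬ X t rewrite t = ∧-zeroʳ (has4 L)

    lifted-true : ∀ X → (has4 L ∧ lifted X) ≡ true → has4 L ≡ true × Σ[ Y ∈ Fm ] X ≡ □ Y × ext Y ≡ true
    lifted-true (□ Y)   e = ∧-conicalˡ (has4 L) _ e , Y , refl , ∧-conicalʳ (has4 L) _ e
    lifted-true (var k) e = ⊥-elim (true≢false (trans (sym e) (∧-zeroʳ (has4 L))))
    lifted-true ⊥'      e = ⊥-elim (true≢false (trans (sym e) (∧-zeroʳ (has4 L))))
    lifted-true (A ⇒ C) e = ⊥-elim (true≢false (trans (sym e) (∧-zeroʳ (has4 L))))

  ext-in : ∀ {X} → □ X ⊑ B → ext X ≡ boxVal w X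
  ext-in {X} p = ext-cases {λ b → b ≡ boxVal w X} X (λ _ → refl)
                          (λ out → ⊥-elim (true≢false (trans (sym (⊑ᵇ-complete p)) out)))

  module _ (adm : Admissible B w) where

    ext-thm : ∀ {X} → thm? X ≡ true → ext X ≡ true
    ext-thm {X} t = ext-cases {λ b → b ≡ true} X (λ p → thm⇒true (adm p) t) (λ _ → cong (_∨ (has4 L ∧ lifted X)) t)

    ext-⊥ : hasP L ≡ true → ext ⊥' ≡ false
    ext-⊥ P = ext-cases {λ b → b ≡ false} ⊥' (λ p → P-⊥-false (adm p) P refl)
                                            (λ _ → outside-false thm?-⊥ (∧-zeroʳ (has4 L)))

    ext-lift : has4 L ≡ true → ∀ {Y} → ext Y ≡ true → ext (□ Y) ≡ true
    ext-lift 4ax {Y} eY = ext-cases {λ b → b ≡ true} (□ Y)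
      (λ p → 4-lift (adm p) 4ax refl (trans (sym (ext-in (□⊑⇒⊑ p))) eY))
      (λ _ → ∨-introʳ (thm? (□ Y)) (∧ᵇ-intro 4ax eY))

    ext-boxRefuted : hasD L ≡ true → ∀ X → boxRefuted? X ≡ true → ext X ≡ false
    ext-boxRefuted D X rb = ext-cases {λ b → b ≡ false} X (λ p → D-boxRefuted (adm p) D rb)
      (λ _ → outside-false (¬true⇒false (λ t → ¬[thm∧boxRefuted] D t rb)) (not-lifted X rb))
      where
      not-lifted : ∀ X → boxRefuted? X ≡ true → (has4 L ∧ lifted X) ≡ false
      not-lifted (var k) _ = ∧-zeroʳ (has4 L)
      not-lifted ⊥'      _ = ∧-zeroʳ (has4 L)
      not-lifted (A ⇒ C) _ = ∧-zeroʳ (has4 L)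
      not-lifted (□ Y)  rb = ∧-false (has4 L) (λ 4ax → ext-boxRefuted D Y (boxRefuted□⇒boxRefuted 4ax D Y rb))

    ext-D : hasD L ≡ true → ∀ X → ext X ≡ true → ext (¬' X) ≡ false
    ext-D D X eX = ext-cases {λ b → b ≡ false} (¬' X) inside
      (λ _ → outside-¬ X (¬true⇒false λ t →
        true≢false (trans (sym eX) (ext-boxRefuted D X (refuted⇒boxRefuted X (thm¬⇒refuted X t))))))
      where
      inside : □ (¬' X) ⊑ B → boxVal w (¬' X) ≡ false
      inside occ = ext-cases {λ b → b ≡ true → boxVal w (¬' X) ≡ false} X
        (λ p → D-neg (adm p) D occ)
        (λ _ e → [ (λ t → D-boxRefuted (adm occ) D (thm⇒boxRefuted¬ X t))
                 , (λ l → let 4ax , Y , X≡□Y , eY = lifted-true X l in by-lift 4ax X≡□Y eY) ]′ (∨-true (thm? X) e))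
        eX
        where
        by-lift : has4 L ≡ true → ∀ {Y} → X ≡ □ Y → ext Y ≡ true → boxVal w (¬' X) ≡ false
        by-lift 4ax {Y} refl eY = D4-negBox (adm {Y} q) D 4ax occ (trans (sym (ext-in q)) eY)
          where
          q : □ Y ⊑ B
          q = ⊑-trans (⊑-□ (⊑-⇒ˡ ⊑-refl)) occ

    ext-D4 : hasD L ≡ true → has4 L ≡ true → ∀ X → ext X ≡ true → ext (¬' (□ X)) ≡ false
    ext-D4 D 4ax X eX = ext-cases {λ b → b ≡ false} (¬' (□ X))
      (λ occ → let q = ⊑-trans (⊑-□ (⊑-⇒ˡ ⊑-refl)) occ in D4-negBox (adm {X} q) D 4ax occ (trans (sym (ext-in q)) eX))
      (λ _ → outside-¬ (□ X) (¬true⇒false λ t → true≢false (trans (sym eX)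
        (ext-boxRefuted D X (refuted□⇒boxRefuted 4ax D X (thm¬⇒refuted (□ X) t))))))

    ext-constraints : ∀ {Occurs} X → Constraints Occurs ext X
    ext-constraints X = record
      { thm⇒true     = ext-thm
      ; P-⊥-false    = λ { P refl → ext-⊥ P }
      ; 4-lift       = λ { 4ax refl → ext-lift 4ax }
      ; D-boxRefuted = λ D → ext-boxRefuted D X
      ; D-neg        = λ D _ → ext-D D X
      ; D4-negBox    = λ D 4ax _ → ext-D4 D 4ax X
      }

    extended : ℕ → Bool
    extended m = caseCode m (λ _ → w m) (w m) (λ _ _ → w m) (λ x → ext (decode x))

    boxVal-extended : ∀ X → boxVal extended X ≡ ext X
    boxVal-extended X = trans (caseCode-□ X) (cong ext (decode-code X))

    extended-agrees : ∀ {Y} → Y ⊑ B → w (code Y) ≡ extended (code Y)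
    extended-agrees {var k} _ = sym (caseCode-var k)
    extended-agrees {⊥'}    _ = sym caseCode-⊥
    extended-agrees {C ⇒ E} _ = sym (caseCode-⇒ C E)
    extended-agrees {□ X}   p = trans (sym (ext-in p)) (sym (boxVal-extended X))

    extended-admissible : ∀ C → Admissible C extended
    extended-admissible C p = Constraints-cong {A = C} (λ {Z} _ → sym (boxVal-extended Z)) p (ext-constraints _)

module Soundness (L : Logic) where
  open Semantics L

  sem-⊑-local : ∀ C {w w′} → (∀ {Y} → Y ⊑ C → w (code Y) ≡ w′ (code Y)) → sem w C ≡ sem w′ C
  sem-⊑-local (var k) agree = agree ⊑-refl
  sem-⊑-local ⊥'      agree = refl
  sem-⊑-local (B ⇒ C) agree = cong₂ _⇒ᵇ_ (sem-⊑-local B (agree ∘ ⊑-⇒ˡ)) (sem-⊑-local C (agree ∘ ⊑-⇒ʳ))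
  sem-⊑-local (□ B)   agree = agree ⊑-refl

  private
    sem-ax1 : ∀ w A B → sem w (A ⇒ (B ⇒ A)) ≡ true
    sem-ax1 w A B with sem w A | sem w B
    ... | true  | true  = refl
    ... | true  | false = refl
    ... | false | _     = refl

    sem-ax2 : ∀ w A B C → sem w ((A ⇒ (B ⇒ C)) ⇒ ((A ⇒ B) ⇒ (A ⇒ C))) ≡ true
    sem-ax2 w A B C with sem w A | sem w B | sem w C
    ... | true  | true  | true  = refl
    ... | true  | true  | false = refl
    ... | true  | false | _     = refl
    ... | false | _     | _     = refl

    sem-ax3 : ∀ w A → sem w ((¬' (¬' A)) ⇒ A) ≡ true
    sem-ax3 w A with sem w A
    ... | true  = refl
    ... | false = refl

    D-sound : ∀ {A} w → hasD L ≡ true → Admissible (¬' ((□ A) ∧' (□ (¬' A)))) w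
            → sem w (¬' ((□ A) ∧' (□ (¬' A)))) ≡ true
    D-sound {A} w D adm = sem-¬∧-intro w (□ A) (□ (¬' A))
      (D-neg (adm (⊑-⇒ˡ (⊑-⇒ˡ (⊑-⇒ˡ ⊑-refl)))) D (⊑-⇒ˡ (⊑-⇒ˡ (⊑-⇒ʳ (⊑-⇒ˡ ⊑-refl)))))

    P-sound : ∀ w → hasP L ≡ true → Admissible (¬' (□ ⊥')) w → sem w (¬' (□ ⊥')) ≡ true
    P-sound w P adm = sem-¬-intro w (□ ⊥') (P-⊥-false (adm (⊑-⇒ˡ ⊑-refl)) P refl)

    4-sound : ∀ {A} w → has4 L ≡ true → Admissible ((□ A) ⇒ (□ (□ A))) w → sem w ((□ A) ⇒ (□ (□ A))) ≡ true
    4-sound w 4ax adm = ⇒ᵇ-intro (4-lift (adm (⊑-⇒ʳ ⊑-refl)) 4ax refl)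

  sound : ∀ {A} → L ⊢ A → thm? A ≡ true
  sound (ax1 A B)          = always?-intro λ w _ → sem-ax1 w A B
  sound (ax2 A B C)        = always?-intro λ w _ → sem-ax2 w A B C
  sound (ax3 A)            = always?-intro λ w _ → sem-ax3 w A
  sound (extra P-NP)       = always?-intro λ w → P-sound w refl
  sound (extra P-NP4)      = always?-intro λ w → P-sound w refl
  sound (extra (D-ND A))   = always?-intro λ w → D-sound w refl
  sound (extra (D-ND4 A))  = always?-intro λ w → D-sound w refl
  sound (extra (4-ND4 A))  = always?-intro λ w → 4-sound w refl
  sound (extra (4-NP4 A))  = always?-intro λ w → 4-sound w refl
  sound (nec d)            = always?-intro λ w adm → thm⇒true (adm ⊑-refl) (sound d)
  sound (mp {A} {B} d e)   = always?-intro λ w adm →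
    let open Extension L {B} {w} in begin
      sem w B                ≡⟨ sem-⊑-local B (extended-agrees adm) ⟩
      sem (extended adm) B   ≡⟨ ⇒ᵇ-elim (always?-elim (sound d) (extended adm) (extended-admissible adm (A ⇒ B)))
                                        (always?-elim (sound e) (extended adm) (extended-admissible adm A)) ⟩
      true                   ∎
    where open ≡-Reasoning

corollary3p11 : (L : Logic) → Σ (PR 1) λ f → (A : Fm) →
                  ((L ⊢ A) × (eval f (code A ∷ []) ≡ 1))
                  ⊎ ((¬ (L ⊢ A)) × (eval f (code A ∷ []) ≡ 0))
corollary3p11 L = decisionProgram L , decides
  where
  open Semantics L
  open Completeness L using (complete)
  open Soundness L using (sound)

  output : ∀ {A b} → thm? A ≡ b → eval (decisionProgram L) (code A ∷ []) ≡ fromBool b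
  output {A} e = trans (decisionProgram-eval L (code A)) (cong fromBool (trans (decideCode-code A) e))

  decides : (A : Fm) → ((L ⊢ A) × (eval (decisionProgram L) (code A ∷ []) ≡ 1))
                     ⊎ ((¬ (L ⊢ A)) × (eval (decisionProgram L) (code A ∷ []) ≡ 0))
  decides A with thm? A in t
  ... | true  = inj₁ (proj₁ (complete A) t , output t)
  ... | false = inj₂ ((λ d → true≢false (trans (sym (sound d)) t)) , output t)
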